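{- Let $G$ be a unicyclic graph of order $n$ with girth $g$ of the form $G=U(T^*_{a_1,b_1},\dots,T^*_{a_g,b_g})$ where, for some $p\ne q$, $b_p=b_q=0$ and $a_p,a_q\ge1$. Let $G_1$ be obtained from $G$ by replacing the branch at $u_p$ by $T^*_{a_p+a_q,0}$ and the branch at $u_q$ by $T^*_{0,0}$, and let $G_2$ be obtained from $G$ by replacing the branch at $u_p$ by $T^*_{0,0}$ and the branch at $u_q$ by $T^*_{a_p+a_q,0}$ (all other branches unchanged). Then $G$, $G_1$, $G_2$ have the same matching number and $W(G)>\min\{W(G_1),W(G_2)\}$.
   Context: All graphs are finite, simple, undirected. $W(H)=\sum_{\{u,v\}\subseteq V(H)} d_H(u,v)$ is the Wiener index, $d_H$ the distance. The matching number is the maximum size of a matching. A unicyclic graph is a connected graph with exactly one cycle, its girth the cycle length. For a cycle $u_1\cdots u_g$ and vertex-disjoint rooted trees $T_1,\dots,T_g$, $U(T_1,\dots,T_g)$ is the graph obtained by identifying $u_i$ with the root of $T_i$. For nonnegative integers $a,b$, $T^*_{a,b}$ is the rooted tree of order $2a+b+1$ obtained from the star $K_{1,a+b}$ with root its center by attaching one new pendant vertex to each of $a$ of its leaves; $T^*_{0,0}$ is a single vertex. -}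

module Defs where

open import Data.Nat using (ℕ; zero; suc; _+_; _≤_; _≡ᵇ_)
open import Data.Bool using (Bool; true; false; _∧_; _∨_; if_then_else_)
open import Data.List using (List; []; _∷_; _++_; map; length; allFin; concatMap)
open import Data.Bool.ListAction using (any)
open import Data.Nat.ListAction using (sum)
open import Data.List.Relation.Unary.All using (All)
open import Data.List.Relation.Unary.Unique.Propositional using (Unique)
open import Data.Fin using (Fin; toℕ) renaming (_≟_ to _≟F_)
open import Data.Product using (Σ; _×_; _,_; proj₁; proj₂)
open import Relation.Nullary using (yes; no)
open import Relation.Nullary.Decidable using (⌊_⌋)
open import Relation.Binary.PropositionalEquality using (_≡_; refl)
open import Relation.Binary.Definitions using (DecidableEquality)

-- Finite simple graphs, given by a vertex type with decidable equality,
-- a list enumerating every vertex exactly once, and a Boolean adjacency.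

record Graph : Set₁ where
  field
    V     : Set
    _≟V_  : DecidableEquality V
    verts : List V
    adj   : V → V → Bool

module _ (G : Graph) where
  open Graph G

  order : ℕ
  order = length verts

  reach : ℕ → V → V → Bool
  reach zero    u v = ⌊ u ≟V v ⌋
  reach (suc k) u v = reach k u v ∨ any (λ w → reach k u w ∧ adj w v) verts

  -- least k < N with f k = true (returns N if there is none)
  leastTrue : ℕ → (ℕ → Bool) → ℕ
  leastTrue zero    f = zero
  leastTrue (suc N) f = if f zero then zero else suc (leastTrue N (λ k → f (suc k)))

  -- distance: length of a shortest walk (= shortest path); in a connected
  -- graph it is < order, so the search bound is sufficient.
  dist : V → V → ℕ
  dist u v = leastTrue order (λ k → reach k u v)

  wienerList : List V → ℕ
  wienerList []       = 0
  wienerList (v ∷ vs) = sum (map (dist v) vs) + wienerList vs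

  W : ℕ
  W = wienerList verts

  IsMatching : List (V × V) → Set
  IsMatching M = All (λ e → adj (proj₁ e) (proj₂ e) ≡ true) M
               × Unique (concatMap (λ e → proj₁ e ∷ proj₂ e ∷ []) M)

  IsMatchingNumber : ℕ → Set
  IsMatchingNumber m =
    Σ (List (V × V)) (λ M → IsMatching M × length M ≡ m)
    × (∀ M → IsMatching M → length M ≤ m)

-- Branch i: root = cyc i (= u_i), star leaves mid i j (j < a_i + b_i),
-- pendant pend i j attached to mid i j for j < a_i.

data UV (g : ℕ) (a b : Fin g → ℕ) : Set where
  cyc  : (i : Fin g) → UV g a b
  mid  : (i : Fin g) → Fin (a i + b i) → UV g a b
  pend : (i : Fin g) → Fin (a i) → UV g a b

module _ {g : ℕ} {a b : Fin g → ℕ} where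

  _≟U_ : DecidableEquality (UV g a b)
  cyc i ≟U cyc i' with i ≟F i'
  ... | yes refl = yes refl
  ... | no ne = no λ { refl → ne refl }
  cyc i ≟U mid i' j' = no λ ()
  cyc i ≟U pend i' j' = no λ ()
  mid i j ≟U cyc i' = no λ ()
  mid i j ≟U mid i' j' with i ≟F i'
  ... | no ne = no λ { refl → ne refl }
  ... | yes refl with j ≟F j'
  ...   | yes refl = yes refl
  ...   | no ne = no λ { refl → ne refl }
  mid i j ≟U pend i' j' = no λ ()
  pend i j ≟U cyc i' = no λ ()
  pend i j ≟U mid i' j' = no λ ()
  pend i j ≟U pend i' j' with i ≟F i'
  ... | no ne = no λ { refl → ne refl }
  ... | yes refl with j ≟F j'
  ...   | yes refl = yes refl
  ...   | no ne = no λ { refl → ne refl }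

eqF : ∀ {g} → Fin g → Fin g → Bool
eqF i j = ⌊ i ≟F j ⌋

cnext : (g : ℕ) → Fin g → ℕ
cnext g i = if suc (toℕ i) ≡ᵇ g then 0 else suc (toℕ i)

Uadj : (g : ℕ) (a b : Fin g → ℕ) → UV g a b → UV g a b → Bool
Uadj g a b (cyc i)    (cyc j)    = (toℕ j ≡ᵇ cnext g i) ∨ (toℕ i ≡ᵇ cnext g j)
Uadj g a b (cyc i)    (mid i' j) = eqF i i'
Uadj g a b (mid i j)  (cyc i')   = eqF i i'
Uadj g a b (mid i j)  (pend i' k) = eqF i i' ∧ (toℕ j ≡ᵇ toℕ k)
Uadj g a b (pend i k) (mid i' j) = eqF i i' ∧ (toℕ j ≡ᵇ toℕ k)
Uadj g a b _          _          = false

Uverts : (g : ℕ) (a b : Fin g → ℕ) → List (UV g a b)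
Uverts g a b = concatMap (λ i → cyc i ∷ (map (mid i) (allFin (a i + b i))
                                          ++ map (pend i) (allFin (a i))))
                         (allFin g)

U : (g : ℕ) (a b : Fin g → ℕ) → Graph
U g a b = record { V = UV g a b ; _≟V_ = _≟U_ ; verts = Uverts g a b ; adj = Uadj g a b }

replace2 : ∀ {g} → (Fin g → ℕ) → Fin g → ℕ → Fin g → ℕ → Fin g → ℕ
replace2 f p x q y i = if eqF i p then x else (if eqF i q then y else f i)

-- The matching number is unchanged because, after trading a matching edge from u_q (or u_p) into a
-- star leaf for the pendant edge at that leaf, moving the arms between u_p and u_q maps matchings
-- injectively to matchings, in both directions.
--
-- For the Wiener index, two vertices not in a common arm are at distance depth x + depth y + c(i, j),
-- where i, j are their roots and c is the distance on the cycle; this is checked by verifying the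
-- breadth-first layering property. Summing, 2 W + S = 2 N H + Σ n_i n_j c(i, j), where the order N,
-- the total depth H and the in-arm correction S depend only on the multiset of arms and so agree for
-- G, G1 and G2, and n_i is the order of the branch at u_i. With x = a_p and y = a_q, moving the arms
-- of u_q to u_p lowers the double sum, hence 2 W, by 8 x y c(p, q) + 4 y (P_q − P_p), where
-- P_r = Σ_{i ≠ p, q} n_i c(r, i); moving them the other way lowers it by 8 x y c(p, q) + 4 x (P_p − P_q).
-- One of the two is positive.

module Submission where

open import Defs
open import Data.Nat.Properties
open import Algebra.Properties.CommutativeSemigroup +-commutativeSemigroup using () renaming (interchange to +-interchange)
open import Algebra.Properties.Semiring.Sum +-*-semiring using (sum-syntax; sum-cong-≗; ∑-distrib-+; *-distribˡ-sum)
open import Data.Bool using (Bool; true; false; _∧_; _∨_; if_then_else_; T) renaming (_≟_ to _≟B_)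
open import Data.Bool.ListAction using (any)
open import Data.Bool.Properties using (∨-comm)
open import Data.Empty using (⊥-elim)
open import Data.Fin using (Fin; toℕ; fromℕ<; _↑ˡ_) renaming (_≟_ to _≟F_; zero to fzero; suc to fsuc)
open import Data.Fin.Properties using (toℕ-injective; toℕ-fromℕ<; toℕ<n; toℕ-↑ˡ) renaming (suc-injective to fsuc-injective)
open import Data.List using (List; []; _∷_; _++_; map; length; concatMap; allFin; tabulate; cartesianProduct)
open import Data.List.Properties using (length-map; length-removeAt′; map-tabulate)
open import Data.List.Relation.Unary.All as All using (All; []; _∷_)
open import Data.List.Relation.Unary.All.Properties using (¬Any⇒All¬; All¬⇒¬Any) renaming (map⁺ to All-map⁺)
open import Data.List.Relation.Unary.AllPairs using ([]; _∷_)
open import Data.List.Relation.Unary.Any as Any using (here; there; index)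
open import Data.List.Relation.Unary.Unique.Propositional using (Unique)
open import Data.List.Relation.Unary.Unique.Propositional.Properties using () renaming (map⁺ to Unique-map⁺)
open import Data.List.Membership.Propositional using (_∈_; _∉_; _─_)
open import Data.List.Membership.Propositional.Properties using (∈-cartesianProduct⁺; ∈-map⁺; ∈-concatMap⁺; ∈-allFin; ∈-++⁺ˡ; ∈-++⁺ʳ)
import Data.List.Membership.DecPropositional as DecMembership
open import Data.Nat using (ℕ; zero; suc; pred; _+_; _*_; _∸_; _≤_; _<_; _⊓_; z≤n; s≤s; _≤?_; _<?_; _≡ᵇ_; _<ᵇ_; >-nonZero)
open import Data.Nat.ListAction using (sum)
open import Data.Nat.Tactic.RingSolver using (solve-∀)
open import Data.Product using (Σ; ∃; _×_; _,_; proj₁; proj₂)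
open import Data.Product.Properties using (≡-dec)
open import Data.Sum using (_⊎_; inj₁; inj₂; [_,_]′)
open import Data.Unit using (⊤; tt)
open import Function using (_∘_)
open import Relation.Nullary using (Dec; yes; no; ¬_)
open import Relation.Nullary.Decidable using (_×-dec_; ¬?)
open import Relation.Binary.PropositionalEquality using (_≡_; _≢_; refl; sym; trans; cong; cong₂; subst; subst₂; module ≡-Reasoning)

∧-true⁻ : ∀ {x y} → x ∧ y ≡ true → x ≡ true × y ≡ true
∧-true⁻ {true} y≡true = refl , y≡true

∧-true⁺ : ∀ {x y} → x ≡ true → y ≡ true → x ∧ y ≡ true
∧-true⁺ refl refl = refl

∨-true⁻ : ∀ {x y} → x ∨ y ≡ true → x ≡ true ⊎ y ≡ true
∨-true⁻ {true}  _       = inj₁ refl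
∨-true⁻ {false} y≡true = inj₂ y≡true

∨-trueˡ : ∀ {x y} → x ≡ true → x ∨ y ≡ true
∨-trueˡ refl = refl

∨-trueʳ : ∀ {x y} → y ≡ true → x ∨ y ≡ true
∨-trueʳ {true}  _    = refl
∨-trueʳ {false} refl = refl

any-true⁺ : ∀ {A : Set} (P : A → Bool) {xs w} → w ∈ xs → P w ≡ true → any P xs ≡ true
any-true⁺ P (here refl) Pw = ∨-trueˡ Pw
any-true⁺ P (there w∈xs) Pw = ∨-trueʳ (any-true⁺ P w∈xs Pw)

any-true⁻ : ∀ {A : Set} (P : A → Bool) xs → any P xs ≡ true → ∃ λ w → P w ≡ true
any-true⁻ P (x ∷ xs) h with P x in Px
... | true  = x , Px
... | false = any-true⁻ P xs h

eqF-≡ : ∀ {g} {i j : Fin g} → eqF i j ≡ true → i ≡ j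
eqF-≡ {i = i} {j} h with i ≟F j | h
... | yes i≡j | _ = i≡j

eqF-refl : ∀ {g} (i : Fin g) → eqF i i ≡ true
eqF-refl i with i ≟F i
... | yes _   = refl
... | no i≢i = ⊥-elim (i≢i refl)

eqF-≢ : ∀ {g} {i j : Fin g} → i ≢ j → eqF i j ≡ false
eqF-≢ {i = i} {j} i≢j with i ≟F j
... | yes i≡j = ⊥-elim (i≢j i≡j)
... | no _    = refl

≡ᵇ-≡ : ∀ {m n} → (m ≡ᵇ n) ≡ true → m ≡ n
≡ᵇ-≡ {m} {n} h = ≡ᵇ⇒≡ m n (subst T (sym h) _)

≡ᵇ-refl : ∀ m → (m ≡ᵇ m) ≡ true
≡ᵇ-refl zero    = refl
≡ᵇ-refl (suc m) = ≡ᵇ-refl m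

eqF-sym : ∀ {g} (i j : Fin g) → eqF i j ≡ eqF j i
eqF-sym i j with i ≟F j | j ≟F i
... | yes _   | yes _   = refl
... | no _    | no _    = refl
... | yes i≡j | no j≢i = ⊥-elim (j≢i (sym i≡j))
... | no i≢j  | yes j≡i = ⊥-elim (i≢j (sym j≡i))

≡ᵇ-sym : ∀ m n → (m ≡ᵇ n) ≡ (n ≡ᵇ m)
≡ᵇ-sym zero    zero    = refl
≡ᵇ-sym zero    (suc n) = refl
≡ᵇ-sym (suc m) zero    = refl
≡ᵇ-sym (suc m) (suc n) = ≡ᵇ-sym m n

<ᵇ-true : ∀ {m n} → m < n → (m <ᵇ n) ≡ true
<ᵇ-true {m} {n} m<n with m <ᵇ n | <⇒<ᵇ m<n
... | true | _ = refl

module Matchings (G : Graph) where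
  open Graph G

  Edge : Set
  Edge = V × V

  endpoints : List Edge → List V
  endpoints = concatMap (λ e → proj₁ e ∷ proj₂ e ∷ [])

  IsEdge : Edge → Set
  IsEdge e = adj (proj₁ e) (proj₂ e) ≡ true

  MatchingAvoiding : List V → List Edge → Set
  MatchingAvoiding S M = IsMatching G M × All (_∉ S) (endpoints M)

  Available : List V → Edge → Set
  Available S e = IsEdge e × proj₁ e ≢ proj₂ e × proj₁ e ∉ S × proj₂ e ∉ S

  available? : ∀ S e → Dec (Available S e)
  available? S (u , v) = adj u v ≟B true ×-dec ¬? (u ≟V v) ×-dec ¬? (u ∈? S) ×-dec ¬? (v ∈? S)
    where open DecMembership _≟V_ using (_∈?_)

  open DecMembership (≡-dec _≟V_ _≟V_) using () renaming (_∈?_ to _∈ₑ?_)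

  ∉-∷⁺ : ∀ {x v : V} {xs} → x ≢ v → v ∉ xs → v ∉ x ∷ xs
  ∉-∷⁺ x≢v _    (here v≡x)   = x≢v (sym v≡x)
  ∉-∷⁺ _   v∉xs (there v∈xs) = v∉xs v∈xs

  ∉-∷⁻ : ∀ {x v : V} {xs} → v ∉ x ∷ xs → x ≢ v × v ∉ xs
  ∉-∷⁻ v∉ = (λ x≡v → v∉ (here (sym x≡v))) , v∉ ∘ there

  avoiding-∷⁻ : ∀ {S e M} → MatchingAvoiding S (e ∷ M) →
                Available S e × MatchingAvoiding (proj₁ e ∷ proj₂ e ∷ S) M
  avoiding-∷⁻ ((isE ∷ isEs , (e₁≢e₂ ∷ e₁≢) ∷ e₂≢ ∷ unique) , e₁∉S ∷ e₂∉S ∷ avoid) =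
    (isE , e₁≢e₂ , e₁∉S , e₂∉S) ,
    (isEs , unique) ,
    All.tabulate (λ v∈ → ∉-∷⁺ (All.lookup e₁≢ v∈) (∉-∷⁺ (All.lookup e₂≢ v∈) (All.lookup avoid v∈)))

  avoiding-∷⁺ : ∀ {S e M} → Available S e → MatchingAvoiding (proj₁ e ∷ proj₂ e ∷ S) M →
                MatchingAvoiding S (e ∷ M)
  avoiding-∷⁺ (isE , e₁≢e₂ , e₁∉S , e₂∉S) ((isEs , unique) , avoid) =
    (isE ∷ isEs ,
     (e₁≢e₂ ∷ All.map (proj₁ ∘ ∉-∷⁻) avoid) ∷ All.map (proj₁ ∘ ∉-∷⁻ ∘ proj₂ ∘ ∉-∷⁻) avoid ∷ unique) ,
    e₁∉S ∷ e₂∉S ∷ All.map (proj₂ ∘ ∉-∷⁻ ∘ proj₂ ∘ ∉-∷⁻) avoid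

  avoiding-⊆ : ∀ {S S' M} → (∀ {v} → v ∈ S' → v ∈ S) → MatchingAvoiding S M → MatchingAvoiding S' M
  avoiding-⊆ S'⊆S (isM , avoid) = isM , All.map (λ v∉S → v∉S ∘ S'⊆S) avoid

  avoiding-member : ∀ {S e M} → MatchingAvoiding S M → e ∈ M → Available S e
  avoiding-member h (here refl) = proj₁ (avoiding-∷⁻ h)
  avoiding-member h (there e∈M) with avoiding-member (proj₂ (avoiding-∷⁻ h)) e∈M
  ... | isE , e₁≢e₂ , e₁∉ , e₂∉ = isE , e₁≢e₂ , e₁∉ ∘ there ∘ there , e₂∉ ∘ there ∘ there

  ─-⊆ : ∀ {e x} {M : List Edge} (e∈M : e ∈ M) → x ∈ M ─ e∈M → x ∈ M
  ─-⊆ (here _)    x∈            = there x∈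
  ─-⊆ (there e∈M) (here x≡y)    = here x≡y
  ─-⊆ (there e∈M) (there x∈)    = there (─-⊆ e∈M x∈)

  avoiding-─ : ∀ {S e M} → MatchingAvoiding S M → (e∈M : e ∈ M) →
               MatchingAvoiding (proj₁ e ∷ proj₂ e ∷ S) (M ─ e∈M)
  avoiding-─ h (here refl) = proj₂ (avoiding-∷⁻ h)
  avoiding-─ {S} {e} {x ∷ M} h (there e∈M) =
    avoiding-∷⁺ x-available (avoiding-⊆ reorder (avoiding-─ h' e∈M))
    where
      x-avail = proj₁ (avoiding-∷⁻ h)
      h' = proj₂ (avoiding-∷⁻ h)
      e-avail = avoiding-member h' e∈M
      x-available : Available (proj₁ e ∷ proj₂ e ∷ S) x
      x-available with x-avail | e-avail
      ... | isE , x₁≢x₂ , x₁∉S , x₂∉S | _ , _ , e₁∉ , e₂∉ =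
        isE , x₁≢x₂ ,
        ∉-∷⁺ (e₁∉ ∘ here) (∉-∷⁺ (e₂∉ ∘ here) x₁∉S) ,
        ∉-∷⁺ (e₁∉ ∘ there ∘ here) (∉-∷⁺ (e₂∉ ∘ there ∘ here) x₂∉S)
      reorder : ∀ {v} → v ∈ proj₁ x ∷ proj₂ x ∷ proj₁ e ∷ proj₂ e ∷ S →
                        v ∈ proj₁ e ∷ proj₂ e ∷ proj₁ x ∷ proj₂ x ∷ S
      reorder (here p)                         = there (there (here p))
      reorder (there (here p))                 = there (there (there (here p)))
      reorder (there (there (here p)))         = here p
      reorder (there (there (there (here p)))) = there (here p)
      reorder (there (there (there (there p)))) = there (there (there (there p)))

  longer : List Edge → List Edge → List Edge
  longer M M' with length M' ≤? length M
  ... | yes _ = M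
  ... | no _  = M'

  longer-≥ˡ : ∀ M M' → length M ≤ length (longer M M')
  longer-≥ˡ M M' with length M' ≤? length M
  ... | yes _     = ≤-refl
  ... | no M'≰M = ≰⇒≥ M'≰M

  longer-≥ʳ : ∀ M M' → length M' ≤ length (longer M M')
  longer-≥ʳ M M' with length M' ≤? length M
  ... | yes M'≤M = M'≤M
  ... | no _     = ≤-refl

  longer-sel : ∀ (P : List Edge → Set) {M M'} → P M → P M' → P (longer M M')
  longer-sel P {M} {M'} PM PM' with length M' ≤? length M
  ... | yes _ = PM
  ... | no _  = PM'

  largestMatching : List Edge → List V → List Edge
  largestMatching []      S = []
  largestMatching (e ∷ C) S with available? S e
  ... | yes _ = longer (e ∷ largestMatching C (proj₁ e ∷ proj₂ e ∷ S)) (largestMatching C S)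
  ... | no _  = largestMatching C S

  largestMatching-avoiding : ∀ C S → MatchingAvoiding S (largestMatching C S)
  largestMatching-avoiding []      S = ([] , []) , []
  largestMatching-avoiding (e ∷ C) S with available? S e
  ... | yes e-avail = longer-sel (MatchingAvoiding S)
                        (avoiding-∷⁺ e-avail (largestMatching-avoiding C _))
                        (largestMatching-avoiding C S)
  ... | no _        = largestMatching-avoiding C S

  ∈-∷-≢ : ∀ {x y : Edge} {C} → x ∈ y ∷ C → x ≢ y → x ∈ C
  ∈-∷-≢ (here x≡y) x≢y = ⊥-elim (x≢y x≡y)
  ∈-∷-≢ (there x∈C) _  = x∈C

  drop-∉ : ∀ {e : Edge} {C M} → e ∉ M → All (_∈ e ∷ C) M → All (_∈ C) M
  drop-∉ e∉M M⊆eC = All.tabulate λ x∈ → ∈-∷-≢ (All.lookup M⊆eC x∈) λ { refl → e∉M x∈ }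

  largestMatching-maximum : ∀ C S M → MatchingAvoiding S M → All (_∈ C) M →
                            length M ≤ length (largestMatching C S)
  largestMatching-maximum []      S []      _ _        = z≤n
  largestMatching-maximum []      S (_ ∷ _) _ (() ∷ _)
  largestMatching-maximum (e ∷ C) S M       h M⊆eC with e ∈ₑ? M | available? S e
  ... | yes e∈M | no e-unavail = ⊥-elim (e-unavail (avoiding-member h e∈M))
  ... | yes e∈M | yes _ = begin
    length M                                                    ≡⟨ length-removeAt′ M (index e∈M) ⟩
    suc (length (M ─ e∈M))                                      ≤⟨ s≤s (largestMatching-maximum C _ _ h' M─e⊆C) ⟩
    length (e ∷ largestMatching C (proj₁ e ∷ proj₂ e ∷ S))      ≤⟨ longer-≥ˡ _ (largestMatching C S) ⟩
    length (longer (e ∷ largestMatching C (proj₁ e ∷ proj₂ e ∷ S)) (largestMatching C S)) ∎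
    where
      open ≤-Reasoning
      h' = avoiding-─ h e∈M
      M─e⊆C : All (_∈ C) (M ─ e∈M)
      M─e⊆C = All.tabulate λ x∈ → ∈-∷-≢ (All.lookup M⊆eC (─-⊆ e∈M x∈))
                λ { refl → proj₁ (proj₂ (proj₂ (avoiding-member h' x∈))) (here refl) }
  ... | no e∉M | yes _ = ≤-trans (largestMatching-maximum C S M h (drop-∉ e∉M M⊆eC))
                                 (longer-≥ʳ (e ∷ largestMatching C (proj₁ e ∷ proj₂ e ∷ S)) (largestMatching C S))
  ... | no e∉M | no _  = largestMatching-maximum C S M h (drop-∉ e∉M M⊆eC)

  maximumMatching-exists : (∀ v → v ∈ verts) → ∃ (IsMatchingNumber G)
  maximumMatching-exists complete = length M₀ , (M₀ , proj₁ (largestMatching-avoiding allEdges []) , refl) , maximum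
    where
      allEdges = cartesianProduct verts verts
      M₀ = largestMatching allEdges []
      maximum : ∀ M → IsMatching G M → length M ≤ length M₀
      maximum M isM = largestMatching-maximum allEdges [] M (isM , All.tabulate (λ _ ()))
                        (All.tabulate λ { {u , v} _ → ∈-cartesianProduct⁺ (complete u) (complete v) })

MatchingsTransfer : Graph → Graph → Set
MatchingsTransfer G H =
  ∀ M → IsMatching G M → Σ (List (Graph.V H × Graph.V H)) λ M' → IsMatching H M' × length M' ≡ length M

IsMatchingNumber-transfer : ∀ G H {m} → MatchingsTransfer G H → MatchingsTransfer H G →
                            IsMatchingNumber G m → IsMatchingNumber H m
IsMatchingNumber-transfer G H G→H H→G ((M , isM , refl) , max) = G→H M isM , λ M' isM' →
  let (M'' , isM'' , same) = H→G M' isM' in subst (_≤ length M) same (max M'' isM'')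

module _ (G H : Graph) where
  open Graph

  mapEdges : (V G → V H) → List (V G × V G) → List (V H × V H)
  mapEdges σ = map λ e → σ (proj₁ e) , σ (proj₂ e)

  matching-map : (σ : V G → V H) → (∀ {x y} → σ x ≡ σ y → x ≡ y) → ∀ M → IsMatching G M →
                 All (λ e → adj H (σ (proj₁ e)) (σ (proj₂ e)) ≡ true) M →
                 IsMatching H (mapEdges σ M) × length (mapEdges σ M) ≡ length M
  matching-map σ σ-inj M (_ , unique) σ-edges =
    (All-map⁺ σ-edges , subst Unique (sym (endpoints-map M)) (Unique-map⁺ σ-inj unique)) , length-map _ M
    where
      endpoints-map : ∀ M → Matchings.endpoints H (mapEdges σ M) ≡ map σ (Matchings.endpoints G M)
      endpoints-map []      = refl
      endpoints-map (e ∷ M) = cong (λ es → σ (proj₁ e) ∷ σ (proj₂ e) ∷ es) (endpoints-map M)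

∑ₗ-syntax : ∀ {A : Set} → List A → (A → ℕ) → ℕ
∑ₗ-syntax xs f = sum (map f xs)

infixl 10 ∑ₗ-syntax
syntax ∑ₗ-syntax xs (λ x → e) = ∑[ x ← xs ] e

module _ {A : Set} where

  ∑ₗ-cong : ∀ (xs : List A) {f g : A → ℕ} → (∀ x → f x ≡ g x) → ∑[ x ← xs ] f x ≡ ∑[ x ← xs ] g x
  ∑ₗ-cong []       f≗g = refl
  ∑ₗ-cong (x ∷ xs) f≗g = cong₂ _+_ (f≗g x) (∑ₗ-cong xs f≗g)

  ∑ₗ-distrib-+ : ∀ (xs : List A) (f g : A → ℕ) → ∑[ x ← xs ] (f x + g x) ≡ ∑[ x ← xs ] f x + ∑[ x ← xs ] g x
  ∑ₗ-distrib-+ []       f g = refl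
  ∑ₗ-distrib-+ (x ∷ xs) f g rewrite ∑ₗ-distrib-+ xs f g = +-interchange (f x) (g x) _ _

  *-distribˡ-∑ₗ : ∀ (xs : List A) k (f : A → ℕ) → ∑[ x ← xs ] (k * f x) ≡ k * ∑[ x ← xs ] f x
  *-distribˡ-∑ₗ []       k f = sym (*-zeroʳ k)
  *-distribˡ-∑ₗ (x ∷ xs) k f rewrite *-distribˡ-∑ₗ xs k f = sym (*-distribˡ-+ k (f x) _)

  ∑ₗ-const : ∀ (xs : List A) c → ∑[ x ← xs ] c ≡ length xs * c
  ∑ₗ-const []       c = refl
  ∑ₗ-const (x ∷ xs) c = cong (c +_) (∑ₗ-const xs c)

  ∑ₗ-++ : ∀ (xs ys : List A) (f : A → ℕ) → ∑[ x ← xs ++ ys ] f x ≡ ∑[ x ← xs ] f x + ∑[ x ← ys ] f x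
  ∑ₗ-++ []       ys f = refl
  ∑ₗ-++ (x ∷ xs) ys f = trans (cong (f x +_) (∑ₗ-++ xs ys f)) (sym (+-assoc (f x) _ _))

  ∑ₗ-tabulate : ∀ n (φ : Fin n → A) (f : A → ℕ) → ∑[ x ← tabulate φ ] f x ≡ ∑[ i < n ] f (φ i)
  ∑ₗ-tabulate zero    φ f = refl
  ∑ₗ-tabulate (suc n) φ f = cong (f (φ fzero) +_) (∑ₗ-tabulate n (λ i → φ (fsuc i)) f)

  ∑ₗ-allFin : ∀ n (φ : Fin n → A) (f : A → ℕ) → ∑[ x ← map φ (allFin n) ] f x ≡ ∑[ i < n ] f (φ i)
  ∑ₗ-allFin n φ f = trans (cong (λ xs → ∑[ x ← xs ] f x) (map-tabulate (λ i → i) φ)) (∑ₗ-tabulate n φ f)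

  ∑ₗ-concatMap-allFin : ∀ n (φ : Fin n → List A) (f : A → ℕ) →
                        ∑[ x ← concatMap φ (allFin n) ] f x ≡ ∑[ i < n ] ∑[ x ← φ i ] f x
  ∑ₗ-concatMap-allFin n φ f = go n (λ i → i)
    where
      go : ∀ m (ψ : Fin m → Fin n) → ∑[ x ← concatMap φ (tabulate ψ) ] f x ≡ ∑[ i < m ] ∑[ x ← φ (ψ i) ] f x
      go zero    ψ = refl
      go (suc m) ψ = trans (∑ₗ-++ (φ (ψ fzero)) _ f) (cong (∑[ x ← φ (ψ fzero) ] f x +_) (go m (λ i → ψ (fsuc i))))

∑-const : ∀ n c → ∑[ i < n ] c ≡ n * c
∑-const zero    c = refl
∑-const (suc n) c = cong (c +_) (∑-const n c)

∑-zero : ∀ n (f : Fin n → ℕ) → (∀ i → f i ≡ 0) → ∑[ i < n ] f i ≡ 0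
∑-zero n f f≗0 = trans (sum-cong-≗ f≗0) (trans (∑-const n 0) (*-zeroʳ n))

∑-single : ∀ n (f : Fin n → ℕ) i → (∀ j → j ≢ i → f j ≡ 0) → ∑[ j < n ] f j ≡ f i
∑-single (suc n) f fzero    others =
  trans (cong (f fzero +_) (∑-zero n _ λ j → others (fsuc j) λ ())) (+-identityʳ _)
∑-single (suc n) f (fsuc i) others rewrite others fzero (λ ()) =
  ∑-single n (λ j → f (fsuc j)) i λ j j≢i → others (fsuc j) (j≢i ∘ fsuc-injective)

∑-indicator : ∀ n t u → ∑[ l < n ] (if t ≡ᵇ toℕ l then u else 0) ≡ (if t <ᵇ n then u else 0)
∑-indicator zero    t       u = refl
∑-indicator (suc n) zero    u = trans (cong (u +_) (∑-zero n _ λ _ → refl)) (+-identityʳ u)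
∑-indicator (suc n) (suc t) u = ∑-indicator n t u

∑-below : ∀ a b u → ∑[ l < a + b ] (if toℕ l <ᵇ a then u else 0) ≡ a * u
∑-below zero    b u = ∑-zero b _ λ _ → refl
∑-below (suc a) b u = cong (u +_) (∑-below a b u)

length-∑ : ∀ {A : Set} (xs : List A) → length xs ≡ ∑[ x ← xs ] 1
length-∑ xs = sym (trans (∑ₗ-const xs 1) (*-identityʳ _))

branchSize : ℕ → ℕ → ℕ
branchSize x y = 1 + (x + y) + x

module UProperties {g : ℕ} {a b : Fin g → ℕ} where

  Uverts-complete : (v : UV g a b) → v ∈ Uverts g a b
  Uverts-complete v = ∈-concatMap⁺ _ (Any.map (λ { refl → ∈-branch v }) (∈-allFin (root v)))
    where
      root : UV g a b → Fin g
      root (cyc i)    = i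
      root (mid i _)  = i
      root (pend i _) = i
      ∈-branch : ∀ v → v ∈ cyc (root v) ∷ (map (mid (root v)) (allFin _) ++ map (pend (root v)) (allFin _))
      ∈-branch (cyc i)    = here refl
      ∈-branch (mid i k)  = there (∈-++⁺ˡ (∈-map⁺ (mid i) (∈-allFin k)))
      ∈-branch (pend i k) = there (∈-++⁺ʳ (map (mid i) (allFin (a i + b i))) (∈-map⁺ (pend i) (∈-allFin k)))

  Uadj-sym : ∀ (x y : UV g a b) → Uadj g a b x y ≡ Uadj g a b y x
  Uadj-sym (cyc i)    (cyc j)    = ∨-comm (toℕ j ≡ᵇ cnext g i) (toℕ i ≡ᵇ cnext g j)
  Uadj-sym (cyc i)    (mid j _)  = eqF-sym i j
  Uadj-sym (cyc i)    (pend j _) = refl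
  Uadj-sym (mid i _)  (cyc j)    = eqF-sym i j
  Uadj-sym (mid i _)  (mid j _)  = refl
  Uadj-sym (mid i k)  (pend j l) = cong (_∧ (toℕ k ≡ᵇ toℕ l)) (eqF-sym i j)
  Uadj-sym (pend i _) (cyc j)    = refl
  Uadj-sym (pend i k) (mid j l)  = cong (_∧ (toℕ l ≡ᵇ toℕ k)) (eqF-sym i j)
  Uadj-sym (pend i _) (pend j _) = refl

  mid-pend-edge : ∀ {i j} (k : Fin (a i + b i)) (l : Fin (a j)) → i ≡ j → toℕ k ≡ toℕ l →
                  Uadj g a b (mid i k) (pend j l) ≡ true
  mid-pend-edge {i} k l refl k≡l rewrite eqF-refl i | k≡l = ≡ᵇ-refl (toℕ l)

  stem : ∀ {i} → Fin (a i) → UV g a b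
  stem {i} l = mid i (l ↑ˡ b i)

  stem-edge : ∀ i (l : Fin (a i)) → Uadj g a b (stem l) (pend i l) ≡ true
  stem-edge i l = mid-pend-edge (l ↑ˡ b i) l refl (toℕ-↑ˡ l (b i))

  pend-neighbour : ∀ {i} {l : Fin (a i)} y → Uadj g a b (pend i l) y ≡ true → y ≡ stem l
  pend-neighbour {i} {l} (mid j m) adjacent with ∧-true⁻ adjacent
  ... | i≡j , m≡l with eqF-≡ {i = i} {j} i≡j
  ... | refl = cong (mid i) (toℕ-injective (trans (≡ᵇ-≡ m≡l) (sym (toℕ-↑ˡ l (b i)))))

  branchSum : Fin g → (UV g a b → ℕ) → ℕ
  branchSum i F = F (cyc i) + (∑[ k < a i + b i ] F (mid i k) + ∑[ l < a i ] F (pend i l))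

  ∑-Uverts : ∀ F → ∑[ x ← Uverts g a b ] F x ≡ ∑[ i < g ] branchSum i F
  ∑-Uverts F = trans (∑ₗ-concatMap-allFin g _ F) (sum-cong-≗ λ i →
    cong (F (cyc i) +_) (trans (∑ₗ-++ (map (mid i) (allFin _)) _ F)
                               (cong₂ _+_ (∑ₗ-allFin _ (mid i) F) (∑ₗ-allFin _ (pend i) F))))

  order-U : order (U g a b) ≡ ∑[ i < g ] branchSize (a i) (b i)
  order-U = trans (length-∑ (Uverts g a b)) (trans (∑-Uverts (λ _ → 1)) (sum-cong-≗ λ i →
    cong suc (cong₂ _+_ (∑-one (a i + b i)) (∑-one (a i)))))
    where
      ∑-one : ∀ n → ∑[ k < n ] 1 ≡ n
      ∑-one n = trans (∑-const n 1) (*-identityʳ n)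

-- Moving arms preserves the matching number

-- A matching edge u_r — mid r k can be traded for mid r k — pend r k: the pendant's only neighbour
-- mid r k is already matched to u_r, so the pendant is free.
module Reroute {g : ℕ} {a b : Fin g → ℕ} (r : Fin g) (br≡0 : b r ≡ 0) where
  open UProperties {g} {a} {b}
  open Matchings (U g a b)

  pendantOf : Fin (a r + b r) → Fin (a r)
  pendantOf k = fromℕ< (subst (toℕ k <_) (trans (cong (a r +_) br≡0) (+-identityʳ (a r))) (toℕ<n k))

  pendantOf-↑ˡ : ∀ k → pendantOf k ↑ˡ b r ≡ k
  pendantOf-↑ˡ k = toℕ-injective (trans (toℕ-↑ˡ (pendantOf k) (b r)) (toℕ-fromℕ< _))

  NotSpoke : Edge → Set
  NotSpoke (cyc i , mid j _) = ¬ (i ≡ r × j ≡ r)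
  NotSpoke (mid j _ , cyc i) = ¬ (i ≡ r × j ≡ r)
  NotSpoke _                 = ⊤

  data SpokeView : Edge → Set where
    spoke  : ∀ k → SpokeView (cyc r , mid r k)
    spoke˘ : ∀ k → SpokeView (mid r k , cyc r)
    other  : ∀ {e} → NotSpoke e → SpokeView e

  spoke? : ∀ e → SpokeView e
  spoke? (cyc i , mid j k) with i ≟F r | j ≟F r
  ... | yes refl | yes refl = spoke k
  ... | no i≢r   | _        = other (i≢r ∘ proj₁)
  ... | yes _    | no j≢r   = other (j≢r ∘ proj₂)
  spoke? (mid j k , cyc i) with i ≟F r | j ≟F r
  ... | yes refl | yes refl = spoke˘ k
  ... | no i≢r   | _        = other (i≢r ∘ proj₁)
  ... | yes _    | no j≢r   = other (j≢r ∘ proj₂)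
  spoke? (cyc _ ,  cyc _)    = other tt
  spoke? (cyc _ ,  pend _ _) = other tt
  spoke? (mid _ _ , mid _ _) = other tt
  spoke? (mid _ _ , pend _ _) = other tt
  spoke? (pend _ _ , _)      = other tt

  pendantEdge : Fin (a r + b r) → Edge
  pendantEdge k = mid r k , pend r (pendantOf k)

  rerouteView : ∀ {e} → SpokeView e → Edge
  rerouteView (spoke k)     = pendantEdge k
  rerouteView (spoke˘ k)    = pendantEdge k
  rerouteView {e} (other _) = e

  reroute : Edge → Edge
  reroute e = rerouteView (spoke? e)

  pendantEdge-isEdge : ∀ k → IsEdge (pendantEdge k)
  pendantEdge-isEdge k = mid-pend-edge k (pendantOf k) refl (sym (toℕ-fromℕ< _))

  reroute-isEdge : ∀ e → IsEdge e → IsEdge (reroute e)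
  reroute-isEdge e isE with spoke? e
  ... | spoke k  = pendantEdge-isEdge k
  ... | spoke˘ k = pendantEdge-isEdge k
  ... | other _  = isE

  reroute-notSpoke : ∀ e → NotSpoke (reroute e)
  reroute-notSpoke e with spoke? e
  ... | spoke k  = tt
  ... | spoke˘ k = tt
  ... | other ns = ns

  anchor : UV g a b → UV g a b
  anchor (pend i l) = stem l
  anchor v          = v

  anchor-edge : ∀ x y → IsEdge (x , y) → anchor x ≡ x ⊎ anchor x ≡ y
  anchor-edge (cyc _)    y _   = inj₁ refl
  anchor-edge (mid _ _)  y _   = inj₁ refl
  anchor-edge (pend i l) y isE = inj₂ (sym (pend-neighbour y isE))

  anchor-pendantOf : ∀ k → anchor (pend r (pendantOf k)) ≡ mid r k
  anchor-pendantOf k = cong (mid r) (pendantOf-↑ˡ k)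

  endpoints-reroute : ∀ {v} M → All IsEdge M → v ∈ endpoints (map reroute M) → anchor v ∈ endpoints M
  endpoints-reroute (e ∷ M) (isE ∷ isEs) v∈ with spoke? e | v∈
  ... | spoke k  | here refl         = there (here refl)
  ... | spoke k  | there (here refl) = there (here (anchor-pendantOf k))
  ... | spoke˘ k | here refl         = here refl
  ... | spoke˘ k | there (here refl) = here (anchor-pendantOf k)
  ... | other _  | here refl with anchor-edge _ _ isE
  ...   | inj₁ ≡x = here ≡x
  ...   | inj₂ ≡y = there (here ≡y)
  endpoints-reroute ((x , y) ∷ M) (isE ∷ isEs) v∈ | other _ | there (here refl)
    with anchor-edge y x (trans (Uadj-sym y x) isE)
  ...   | inj₁ ≡y = there (here ≡y)
  ...   | inj₂ ≡x = here ≡x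
  endpoints-reroute (e ∷ M) (isE ∷ isEs) v∈ | _ | there (there v∈M) =
    there (there (endpoints-reroute M isEs v∈M))

  reroute-fresh : ∀ {v} M → All IsEdge M → anchor v ∉ endpoints M → All (v ≢_) (endpoints (map reroute M))
  reroute-fresh M isEs v∉ = ¬Any⇒All¬ _ (v∉ ∘ endpoints-reroute M isEs)

  anchor-∉ : ∀ {x y} M → IsEdge (x , y) → x ∉ endpoints M → y ∉ endpoints M → anchor x ∉ endpoints M
  anchor-∉ {x} {y} M isE x∉ y∉ with anchor-edge x y isE
  ... | inj₁ ≡x = subst (_∉ endpoints M) (sym ≡x) x∉
  ... | inj₂ ≡y = subst (_∉ endpoints M) (sym ≡y) y∉

  reroute-unique : ∀ M → All IsEdge M → Unique (endpoints M) → Unique (endpoints (map reroute M))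
  reroute-unique []      _            _ = []
  reroute-unique (e ∷ M) (isE ∷ isEs) ((x≢y ∷ x∉M) ∷ y∉M ∷ unique) with spoke? e
  ... | spoke k  = ((λ ()) ∷ reroute-fresh M isEs (All¬⇒¬Any y∉M)) ∷
                   reroute-fresh M isEs (subst (_∉ endpoints M) (sym (anchor-pendantOf k)) (All¬⇒¬Any y∉M)) ∷
                   reroute-unique M isEs unique
  ... | spoke˘ k = ((λ ()) ∷ reroute-fresh M isEs (All¬⇒¬Any x∉M)) ∷
                   reroute-fresh M isEs (subst (_∉ endpoints M) (sym (anchor-pendantOf k)) (All¬⇒¬Any x∉M)) ∷
                   reroute-unique M isEs unique
  ... | other _  = (x≢y ∷ reroute-fresh M isEs (anchor-∉ M isE (All¬⇒¬Any x∉M) (All¬⇒¬Any y∉M))) ∷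
                   reroute-fresh M isEs (anchor-∉ M (trans (Uadj-sym (proj₂ e) (proj₁ e)) isE) (All¬⇒¬Any y∉M) (All¬⇒¬Any x∉M)) ∷
                   reroute-unique M isEs unique

  reroute-matching : ∀ M → IsMatching (U g a b) M →
                     IsMatching (U g a b) (map reroute M) × All NotSpoke (map reroute M)
  reroute-matching M (isEs , unique) =
    (All-map⁺ (All.map (λ {e} → reroute-isEdge e) isEs) , reroute-unique M isEs unique) ,
    All-map⁺ (All.tabulate λ {e} _ → reroute-notSpoke e)

-- Arm t at u_i moves to arm P i t at u_(B i t). Only arms at u_r move, so only spokes at r can
-- stop being edges, and reroute has removed those.
module ArmRelabel {g : ℕ} {a b a' b' : Fin g → ℕ}
  (B : Fin g → ℕ → Fin g) (P : Fin g → ℕ → ℕ)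
  (mid-fits : ∀ i t → t < a i + b i → P i t < a' (B i t) + b' (B i t))
  (pend-fits : ∀ i t → t < a i → P i t < a' (B i t))
  (arm-injective : ∀ i j s t → s < a i + b i → t < a j + b j → B i s ≡ B j t → P i s ≡ P j t → i ≡ j × s ≡ t)
  (r : Fin g) (br≡0 : b r ≡ 0) (B-fixes : ∀ i t → i ≢ r → B i t ≡ i) where

  open Reroute {g} {a} {b} r br≡0 using (NotSpoke; reroute; reroute-matching)
  open UProperties

  relabel : UV g a b → UV g a' b'
  relabel (cyc i)    = cyc i
  relabel (mid i k)  = mid (B i (toℕ k)) (fromℕ< (mid-fits i (toℕ k) (toℕ<n k)))
  relabel (pend i l) = pend (B i (toℕ l)) (fromℕ< (pend-fits i (toℕ l) (toℕ<n l)))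

  private
    mid-injective : ∀ {i j} {x : Fin (a' i + b' i)} {y : Fin (a' j + b' j)} →
                    mid {g} {a'} {b'} i x ≡ mid j y → i ≡ j × toℕ x ≡ toℕ y
    mid-injective refl = refl , refl

    pend-injective : ∀ {i j} {x : Fin (a' i)} {y : Fin (a' j)} →
                     pend {g} {a'} {b'} i x ≡ pend j y → i ≡ j × toℕ x ≡ toℕ y
    pend-injective refl = refl , refl

    toℕ-fromℕ<-injective : ∀ {m n k l} .{m<k : m < k} .{n<l : n < l} →
                           toℕ (fromℕ< m<k) ≡ toℕ (fromℕ< n<l) → m ≡ n
    toℕ-fromℕ<-injective eq = trans (sym (toℕ-fromℕ< _)) (trans eq (toℕ-fromℕ< _))

    pend<mid : ∀ {i} (l : Fin (a i)) → toℕ l < a i + b i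
    pend<mid {i} l = ≤-trans (toℕ<n l) (m≤m+n (a i) (b i))

  relabel-injective : ∀ {x y} → relabel x ≡ relabel y → x ≡ y
  relabel-injective {cyc i}    {cyc i}    refl = refl
  relabel-injective {mid i k}  {mid j l}  eq with mid-injective eq
  ... | B≡ , P≡ with arm-injective i j _ _ (toℕ<n k) (toℕ<n l) B≡ (toℕ-fromℕ<-injective P≡)
  ...   | refl , k≡l = cong (mid i) (toℕ-injective k≡l)
  relabel-injective {pend i k} {pend j l} eq with pend-injective eq
  ... | B≡ , P≡ with arm-injective i j _ _ (pend<mid k) (pend<mid l) B≡ (toℕ-fromℕ<-injective P≡)
  ...   | refl , k≡l = cong (pend i) (toℕ-injective k≡l)

  relabel-isEdge : ∀ x y → Uadj g a b x y ≡ true → NotSpoke (x , y) → Uadj g a' b' (relabel x) (relabel y) ≡ true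
  relabel-isEdge (cyc i)    (cyc j)    isE _ = isE
  relabel-isEdge (cyc i)    (mid j k)  isE notSpoke with eqF-≡ {i = i} {j} isE
  ... | refl rewrite B-fixes i (toℕ k) (λ i≡r → notSpoke (i≡r , i≡r)) = eqF-refl i
  relabel-isEdge (mid j k)  (cyc i)    isE notSpoke with eqF-≡ {i = j} {i} isE
  ... | refl rewrite B-fixes j (toℕ k) (λ j≡r → notSpoke (j≡r , j≡r)) = eqF-refl j
  relabel-isEdge (mid i k)  (pend j l) isE _ with ∧-true⁻ isE
  ... | i≡j , k≡l with eqF-≡ {i = i} {j} i≡j | ≡ᵇ-≡ {toℕ k} {toℕ l} k≡l
  ...   | refl | k≡l′ = mid-pend-edge {a = a'} {b = b'} _ _ (cong (B i) k≡l′)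
                          (trans (toℕ-fromℕ< _) (trans (cong (P i) k≡l′) (sym (toℕ-fromℕ< _))))
  relabel-isEdge (pend j l) (mid i k)  isE _ =
    trans (Uadj-sym {a = a'} {b = b'} (relabel (pend j l)) (relabel (mid i k)))
          (relabel-isEdge (mid i k) (pend j l) (trans (Uadj-sym {a = a} {b = b} (mid i k) (pend j l)) isE) tt)

  matchingsTransfer : MatchingsTransfer (U g a b) (U g a' b')
  matchingsTransfer M isM with reroute-matching M isM
  ... | isM′ , notSpokes = mapEdges (U g a b) (U g a' b') relabel (map reroute M) ,
    proj₁ image , trans (proj₂ image) (length-map reroute M)
    where
      image = matching-map (U g a b) (U g a' b') relabel relabel-injective (map reroute M) isM′
                (All.zipWith (λ { {x , y} (isE , ns) → relabel-isEdge x y isE ns }) (proj₁ isM′ , notSpokes))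

record IsArmMerge {g : ℕ} (p q : Fin g) (a b a' b' : Fin g → ℕ) : Set where
  field
    p≢q      : p ≢ q
    b-p      : b p ≡ 0
    b-q      : b q ≡ 0
    a'-p     : a' p ≡ a p + a q
    a'-q     : a' q ≡ 0
    b'-p     : b' p ≡ 0
    b'-q     : b' q ≡ 0
    a'-other : ∀ i → i ≢ p → i ≢ q → a' i ≡ a i
    b'-other : ∀ i → i ≢ p → i ≢ q → b' i ≡ b i

module _ {g : ℕ} {p q : Fin g} {a b a' b' : Fin g → ℕ} (merge : IsArmMerge p q a b a' b') where
  open IsArmMerge merge

  private
    ab-p : a p + b p ≡ a p
    ab-p = trans (cong (a p +_) b-p) (+-identityʳ (a p))

    ab-q : a q + b q ≡ a q
    ab-q = trans (cong (a q +_) b-q) (+-identityʳ (a q))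

    ab'-p : a' p + b' p ≡ a p + a q
    ab'-p = trans (cong₂ _+_ a'-p b'-p) (+-identityʳ _)

    -- Arm t at u_q becomes arm a p + t at u_p; splitting moves the arms t ≥ a p of u_p back.
    mergeBranch : Fin g → ℕ → Fin g
    mergeBranch i t with i ≟F q
    ... | yes _ = p
    ... | no _  = i

    mergeIndex : Fin g → ℕ → ℕ
    mergeIndex i t with i ≟F q
    ... | yes _ = a p + t
    ... | no _  = t

    mergeBranch-fixes : ∀ i t → i ≢ q → mergeBranch i t ≡ i
    mergeBranch-fixes i t i≢q with i ≟F q
    ... | yes i≡q = ⊥-elim (i≢q i≡q)
    ... | no _    = refl

    mergeMid-fits : ∀ i t → t < a i + b i → mergeIndex i t < a' (mergeBranch i t) + b' (mergeBranch i t)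
    mergeMid-fits i t t< with i ≟F q
    ... | yes refl rewrite ab'-p = +-monoʳ-< (a p) (subst (t <_) ab-q t<)
    ... | no i≢q with i ≟F p
    ...   | yes refl rewrite ab'-p = ≤-trans (subst (t <_) ab-p t<) (m≤m+n (a p) (a q))
    ...   | no i≢p rewrite a'-other i i≢p i≢q | b'-other i i≢p i≢q = t<

    mergePend-fits : ∀ i t → t < a i → mergeIndex i t < a' (mergeBranch i t)
    mergePend-fits i t t< with i ≟F q
    ... | yes refl rewrite a'-p = +-monoʳ-< (a p) t<
    ... | no i≢q with i ≟F p
    ...   | yes refl rewrite a'-p = ≤-trans t< (m≤m+n (a p) (a q))
    ...   | no i≢p rewrite a'-other i i≢p i≢q = t<

    merge-injective : ∀ i j s t → s < a i + b i → t < a j + b j →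
                      mergeBranch i s ≡ mergeBranch j t → mergeIndex i s ≡ mergeIndex j t → i ≡ j × s ≡ t
    merge-injective i j s t s< t< B≡ P≡ with i ≟F q | j ≟F q
    ... | yes refl | yes refl = refl , +-cancelˡ-≡ (a p) s t P≡
    ... | yes refl | no _ with B≡
    ...   | refl = ⊥-elim (m+n≮m (a p) s (subst (_< a p) (sym P≡) (subst (t <_) ab-p t<)))
    merge-injective i j s t s< t< B≡ P≡ | no _ | yes refl with B≡
    ...   | refl = ⊥-elim (m+n≮m (a p) t (subst (_< a p) P≡ (subst (s <_) ab-p s<)))
    merge-injective i j s t s< t< B≡ P≡ | no _ | no _ = B≡ , P≡

    splitBranch : Fin g → ℕ → Fin g
    splitBranch i t with i ≟F p | t <? a p
    ... | yes _ | yes _ = p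
    ... | yes _ | no _  = q
    ... | no _  | _     = i

    splitIndex : Fin g → ℕ → ℕ
    splitIndex i t with i ≟F p | t <? a p
    ... | yes _ | yes _ = t
    ... | yes _ | no _  = t ∸ a p
    ... | no _  | _     = t

    splitBranch-fixes : ∀ i t → i ≢ p → splitBranch i t ≡ i
    splitBranch-fixes i t i≢p with i ≟F p
    ... | yes i≡p = ⊥-elim (i≢p i≡p)
    ... | no _    = refl

    splitMid-fits : ∀ i t → t < a' i + b' i → splitIndex i t < a (splitBranch i t) + b (splitBranch i t)
    splitMid-fits i t t< with i ≟F p | t <? a p
    ... | yes refl | yes t<ap = ≤-trans t<ap (m≤m+n (a p) (b p))
    ... | yes refl | no t≮ap rewrite ab-q =
      subst (t ∸ a p <_) (m+n∸m≡n (a p) (a q)) (∸-monoˡ-< (subst (t <_) ab'-p t<) (≮⇒≥ t≮ap))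
    ... | no i≢p   | _ with i ≟F q
    ...   | yes refl rewrite a'-q | b'-q = ⊥-elim (n≮0 t<)
    ...   | no i≢q rewrite a'-other i i≢p i≢q | b'-other i i≢p i≢q = t<

    splitPend-fits : ∀ i t → t < a' i → splitIndex i t < a (splitBranch i t)
    splitPend-fits i t t< with i ≟F p | t <? a p
    ... | yes refl | yes t<ap = t<ap
    ... | yes refl | no t≮ap =
      subst (t ∸ a p <_) (m+n∸m≡n (a p) (a q)) (∸-monoˡ-< (subst (t <_) a'-p t<) (≮⇒≥ t≮ap))
    ... | no i≢p   | _ with i ≟F q
    ...   | yes refl rewrite a'-q = ⊥-elim (n≮0 t<)
    ...   | no i≢q rewrite a'-other i i≢p i≢q = t<

    split-injective : ∀ i j s t → s < a' i + b' i → t < a' j + b' j →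
                      splitBranch i s ≡ splitBranch j t → splitIndex i s ≡ splitIndex j t → i ≡ j × s ≡ t
    split-injective i j s t s< t< B≡ P≡ with i ≟F p | j ≟F p | s <? a p | t <? a p
    ... | yes refl | yes refl | yes _   | yes _   = refl , P≡
    ... | yes refl | yes refl | yes _   | no _    = ⊥-elim (p≢q B≡)
    ... | yes refl | yes refl | no _    | yes _   = ⊥-elim (p≢q (sym B≡))
    ... | yes refl | yes refl | no s≮ap | no t≮ap = refl , ∸-cancelʳ-≡ (≮⇒≥ s≮ap) (≮⇒≥ t≮ap) P≡
    ... | yes refl | no j≢p   | yes _   | _       = ⊥-elim (j≢p (sym B≡))
    ... | yes refl | no _     | no _    | _ with B≡
    ...   | refl rewrite a'-q | b'-q = ⊥-elim (n≮0 t<)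
    split-injective i j s t s< t< B≡ P≡ | no i≢p | yes refl | _ | yes _ = ⊥-elim (i≢p B≡)
    split-injective i j s t s< t< B≡ P≡ | no _   | yes refl | _ | no _ with B≡
    ...   | refl rewrite a'-q | b'-q = ⊥-elim (n≮0 s<)
    split-injective i j s t s< t< B≡ P≡ | no _   | no _     | _ | _ = B≡ , P≡

  IsMatchingNumber-merge : ∀ {m} → IsMatchingNumber (U g a b) m → IsMatchingNumber (U g a' b') m
  IsMatchingNumber-merge = IsMatchingNumber-transfer (U g a b) (U g a' b')
    (ArmRelabel.matchingsTransfer mergeBranch mergeIndex mergeMid-fits mergePend-fits merge-injective q b-q mergeBranch-fixes)
    (ArmRelabel.matchingsTransfer splitBranch splitIndex splitMid-fits splitPend-fits split-injective p b'-p splitBranch-fixes)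

-- Distances as breadth-first layerings

module _ (G : Graph) where
  open Graph G

  leastTrue-≤ : ∀ N (h : ℕ → Bool) {j} → h j ≡ true → leastTrue G N h ≤ j
  leastTrue-≤ zero    h _ = z≤n
  leastTrue-≤ (suc N) h {j} hj with h zero in h0
  ... | true  = z≤n
  leastTrue-≤ (suc N) h {zero}  hj | false with () ← trans (sym hj) h0
  leastTrue-≤ (suc N) h {suc j} hj | false = s≤s (leastTrue-≤ N (λ k → h (suc k)) hj)

  leastTrue-true : ∀ N (h : ℕ → Bool) → leastTrue G N h < N → h (leastTrue G N h) ≡ true
  leastTrue-true (suc N) h lt<N with h zero in h0
  ... | true  = h0
  ... | false = leastTrue-true N (λ k → h (suc k)) (≤-pred lt<N)

  leastTrue-minimum : ∀ N (h : ℕ → Bool) n → n < N → h n ≡ true → (∀ k → h k ≡ true → n ≤ k) →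
                      leastTrue G N h ≡ n
  leastTrue-minimum N h n n<N hn minimal =
    ≤-antisym (leastTrue-≤ N h hn) (minimal _ (leastTrue-true N h (≤-<-trans (leastTrue-≤ N h hn) n<N)))

  leastTrue-cong : ∀ N (h h' : ℕ → Bool) → (∀ k → h k ≡ h' k) → leastTrue G N h ≡ leastTrue G N h'
  leastTrue-cong zero    h h' h≗h' = refl
  leastTrue-cong (suc N) h h' h≗h' rewrite h≗h' zero with h' zero
  ... | true  = refl
  ... | false = cong suc (leastTrue-cong N (λ k → h (suc k)) (λ k → h' (suc k)) (λ k → h≗h' (suc k)))

  reach-zero : ∀ {u v} → reach G 0 u v ≡ true → u ≡ v
  reach-zero {u} {v} h with u ≟V v | h
  ... | yes u≡v | _ = u≡v

  reach-refl : ∀ u → reach G 0 u u ≡ true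
  reach-refl u with u ≟V u
  ... | yes _   = refl
  ... | no u≢u = ⊥-elim (u≢u refl)

  reach-suc : ∀ k {u v} → reach G k u v ≡ true → reach G (suc k) u v ≡ true
  reach-suc k = ∨-trueˡ

  reach-mono : ∀ {k j u v} → k ≤ j → reach G k u v ≡ true → reach G j u v ≡ true
  reach-mono {k} {j} k≤j h with m≤n⇒∃[o]m+o≡n k≤j
  ... | o , refl = go o
    where
      go : ∀ o → reach G (k + o) _ _ ≡ true
      go zero    rewrite +-identityʳ k = h
      go (suc o) rewrite +-suc k o = reach-suc (k + o) (go o)

  reach-last : ∀ k {u v} → reach G (suc k) u v ≡ true →
               reach G k u v ≡ true ⊎ ∃ λ w → reach G k u w ≡ true × adj w v ≡ true
  reach-last k h with ∨-true⁻ h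
  ... | inj₁ uv = inj₁ uv
  ... | inj₂ via with any-true⁻ _ verts via
  ...   | w , uwv = inj₂ (w , ∧-true⁻ uwv)

  record IsLayering (u : V) (f : V → ℕ) : Set where
    field
      root      : f u ≡ 0
      root-only : ∀ v → f v ≡ 0 → u ≡ v
      descend   : ∀ v k → f v ≡ suc k → ∃ λ w → adj w v ≡ true × f w ≡ k
      lipschitz : ∀ w v → adj w v ≡ true → f v ≤ suc (f w)

  layering-≤-reach : ∀ {u f} → IsLayering u f → ∀ k {v} → reach G k u v ≡ true → f v ≤ k
  layering-≤-reach L zero    uv with reach-zero uv
  ... | refl = ≤-reflexive (IsLayering.root L)
  layering-≤-reach L (suc k) uv with reach-last k uv
  ... | inj₁ uv′          = m≤n⇒m≤1+n (layering-≤-reach L k uv′)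
  ... | inj₂ (w , uw , wv) = ≤-trans (IsLayering.lipschitz L w _ wv) (s≤s (layering-≤-reach L k uw))

  dist-≤ : ∀ {u v} k → reach G k u v ≡ true → dist G u v ≤ k
  dist-≤ k = leastTrue-≤ (order G) _

  dist-reach : ∀ {u v} → dist G u v < order G → reach G (dist G u v) u v ≡ true
  dist-reach = leastTrue-true (order G) _

  module _ (complete : ∀ v → v ∈ verts) where

    reach-step : ∀ k {u w v} → reach G k u w ≡ true → adj w v ≡ true → reach G (suc k) u v ≡ true
    reach-step k {u} {w} {v} uw wv = ∨-trueʳ (any-true⁺ (λ z → reach G k u z ∧ adj z v) (complete w) (∧-true⁺ uw wv))

    module _ (adj-sym : ∀ x y → adj x y ≡ adj y x) where

      reach-prepend : ∀ k {v w u} → adj v w ≡ true → reach G k w u ≡ true → reach G (suc k) v u ≡ true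
      reach-prepend zero    vw wu with reach-zero wu
      ... | refl = reach-step 0 (reach-refl _) vw
      reach-prepend (suc k) vw wu with reach-last k wu
      ... | inj₁ wu′              = reach-suc (suc k) (reach-prepend k vw wu′)
      ... | inj₂ (z , wz , zu)    = reach-step (suc k) (reach-prepend k vw wz) zu

      reach-sym : ∀ k {u v} → reach G k u v ≡ true → reach G k v u ≡ true
      reach-sym zero    uv with reach-zero uv
      ... | refl = reach-refl _
      reach-sym (suc k) uv with reach-last k uv
      ... | inj₁ uv′          = reach-suc k (reach-sym k uv′)
      ... | inj₂ (z , uz , zv) = reach-prepend k (trans (adj-sym _ z) zv) (reach-sym k uz)

      dist-sym : ∀ u v → dist G u v ≡ dist G v u
      dist-sym u v = leastTrue-cong (order G) _ _ reach-sym-≡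
        where
          reach-sym-≡ : ∀ k → reach G k u v ≡ reach G k v u
          reach-sym-≡ k with reach G k u v in uv | reach G k v u in vu
          ... | true  | true  = refl
          ... | false | false = refl
          ... | true  | false with () ← trans (sym (reach-sym k uv)) vu
          ... | false | true  with () ← trans (sym (reach-sym k vu)) uv

    reach-layering : ∀ {u f} → IsLayering u f → ∀ k {v} → f v ≤ k → reach G k u v ≡ true
    reach-layering L zero {v} fv≤0 with IsLayering.root-only L v (n≤0⇒n≡0 fv≤0)
    ... | refl = reach-refl _
    reach-layering L (suc k) {v} fv≤ with m≤n⇒m<n∨m≡n fv≤
    ... | inj₁ fv<  = reach-suc k (reach-layering L k (≤-pred fv<))
    ... | inj₂ fv≡ with IsLayering.descend L v k fv≡
    ...   | w , wv , fw≡k = reach-step k (reach-layering L k (≤-reflexive fw≡k)) wv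

    -- dist only searches walk lengths below order G, hence the bound on f v.
    dist-layering : ∀ {u f} → IsLayering u f → ∀ v → f v < order G → dist G u v ≡ f v
    dist-layering L v fv< =
      leastTrue-minimum (order G) _ _ fv< (reach-layering L _ ≤-refl) (λ k → layering-≤-reach L k)

    dist-isLayering : ∀ {u} N → N < order G → (∀ v → reach G N u v ≡ true) → IsLayering u (dist G u)
    dist-isLayering {u} N N<order reachable = record
      { root      = n≤0⇒n≡0 (dist-≤ 0 (reach-refl u))
      ; root-only = λ v d≡0 → reach-zero (subst (λ k → reach G k u v ≡ true) d≡0 (dist-reach (dist<order v)))
      ; descend   = descend
      ; lipschitz = lipschitz
      }
      where
        dist<order : ∀ v → dist G u v < order G
        dist<order v = ≤-<-trans (dist-≤ N (reachable v)) N<order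
        lipschitz : ∀ w v → adj w v ≡ true → dist G u v ≤ suc (dist G u w)
        lipschitz w v wv = dist-≤ (suc (dist G u w)) (reach-step (dist G u w) (dist-reach (dist<order w)) wv)
        descend : ∀ v k → dist G u v ≡ suc k → ∃ λ w → adj w v ≡ true × dist G u w ≡ k
        descend v k d≡ with reach-last k (subst (λ j → reach G j u v ≡ true) d≡ (dist-reach (dist<order v)))
        ... | inj₁ uv = ⊥-elim (1+n≰n (subst (_≤ k) d≡ (dist-≤ k uv)))
        ... | inj₂ (w , uw , wv) = w , wv , ≤-antisym (dist-≤ k uw) (≤-pred (subst (_≤ suc (dist G u w)) d≡ (lipschitz w v wv)))

cnext-< : ∀ {g} (i : Fin g) → suc (toℕ i) < g → cnext g i ≡ suc (toℕ i)
cnext-< {g} i i+1<g with suc (toℕ i) ≡ᵇ g in eq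
... | false = refl
... | true  = ⊥-elim (<-irrefl (≡ᵇ-≡ eq) i+1<g)

cyc-adjacent : ∀ {g a b} (i j : Fin g) → toℕ j ≡ suc (toℕ i) → Uadj g a b (cyc i) (cyc j) ≡ true
cyc-adjacent {g} i j j≡i+1 rewrite cnext-< i (subst (_< g) j≡i+1 (toℕ<n j)) | j≡i+1 = ∨-trueˡ (≡ᵇ-refl (suc (toℕ i)))

module Cycle (g : ℕ) (0<g : 0 < g) where

  noArms : Fin g → ℕ
  noArms _ = 0

  C : Graph
  C = U g noArms noArms

  C-complete : ∀ v → v ∈ Uverts g noArms noArms
  C-complete = UProperties.Uverts-complete

  C-adj-sym : ∀ x y → Uadj g noArms noArms x y ≡ Uadj g noArms noArms y x
  C-adj-sym = UProperties.Uadj-sym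

  order-C : order C ≡ g
  order-C = trans (UProperties.order-U {g} {noArms} {noArms}) (trans (∑-const g 1) (*-identityʳ g))

  reach-forward : ∀ n (i j : Fin g) → toℕ j ≡ toℕ i + n → reach C n (cyc i) (cyc j) ≡ true
  reach-forward zero    i j j≡i+0 rewrite toℕ-injective (trans j≡i+0 (+-identityʳ (toℕ i))) = reach-refl C (cyc i)
  reach-forward (suc n) i j j≡i+n+1 =
    reach-step C C-complete n (reach-forward n i j′ (toℕ-fromℕ< _))
               (cyc-adjacent {a = noArms} {b = noArms} j′ j (trans j≡i+n+1 (trans (+-suc (toℕ i) n) (cong suc (sym (toℕ-fromℕ< _))))))
    where
      j′ : Fin g
      j′ = fromℕ< (<-trans (+-monoʳ-< (toℕ i) (n<1+n n)) (subst (_< g) j≡i+n+1 (toℕ<n j)))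

  ∸-≤-pred : ∀ (j i : Fin g) → toℕ j ∸ toℕ i ≤ pred g
  ∸-≤-pred j i = ≤-trans (m∸n≤m (toℕ j) (toℕ i)) (<⇒≤pred (toℕ<n j))

  cycle-connected : ∀ i v → reach C (pred g) (cyc i) v ≡ true
  cycle-connected i (cyc j) with ≤-total (toℕ i) (toℕ j)
  ... | inj₁ i≤j = reach-mono C (∸-≤-pred j i) (reach-forward _ i j (sym (m+[n∸m]≡n i≤j)))
  ... | inj₂ j≤i = reach-sym C C-complete C-adj-sym (pred g)
                     (reach-mono C (∸-≤-pred i j) (reach-forward _ j i (sym (m+[n∸m]≡n j≤i))))

  cycleDist : Fin g → Fin g → ℕ
  cycleDist i j = dist C (cyc i) (cyc j)

  cycle-isLayering : ∀ i → IsLayering C (cyc i) (dist C (cyc i))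
  cycle-isLayering i = dist-isLayering C C-complete (pred g)
    (subst (pred g <_) (sym order-C) (≤-reflexive (suc-pred g {{>-nonZero 0<g}}))) (cycle-connected i)

  cycleDist-refl : ∀ i → cycleDist i i ≡ 0
  cycleDist-refl i = IsLayering.root (cycle-isLayering i)

  cycleDist-≡0 : ∀ {i j} → cycleDist i j ≡ 0 → i ≡ j
  cycleDist-≡0 {i} {j} d≡0 with IsLayering.root-only (cycle-isLayering i) (cyc j) d≡0
  ... | refl = refl

  cycleDist-sym : ∀ i j → cycleDist i j ≡ cycleDist j i
  cycleDist-sym i j = dist-sym C C-complete C-adj-sym (cyc i) (cyc j)

  cycleDist-≤ : ∀ i j → cycleDist i j ≤ pred g
  cycleDist-≤ i j = dist-≤ C (pred g) (cycle-connected i (cyc j))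

  cycleDist-descend : ∀ i j k → cycleDist i j ≡ suc k →
                      ∃ λ j′ → Uadj g noArms noArms (cyc j′) (cyc j) ≡ true × cycleDist i j′ ≡ k
  cycleDist-descend i j k d≡ with IsLayering.descend (cycle-isLayering i) (cyc j) k d≡
  ... | cyc j′ , adjacent , d′≡ = j′ , adjacent , d′≡

  cycleDist-lipschitz : ∀ i w v → Uadj g noArms noArms (cyc w) (cyc v) ≡ true → cycleDist i v ≤ suc (cycleDist i w)
  cycleDist-lipschitz i w v = IsLayering.lipschitz (cycle-isLayering i) (cyc w) (cyc v)

  weightedDist : (Fin g → ℕ) → Fin g → ℕ
  weightedDist u i = ∑[ j < g ] (u j * cycleDist i j)

  energy : (Fin g → ℕ) → ℕ
  energy u = ∑[ i < g ] (u i * weightedDist u i)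

module UDistance (g : ℕ) (0<g : 0 < g) (a b : Fin g → ℕ) where
  open UProperties {g} {a} {b}
  open Cycle g 0<g using (cycleDist; cycleDist-refl; cycleDist-≡0; cycleDist-≤; cycleDist-descend; cycleDist-lipschitz)

  G : Graph
  G = U g a b

  branch : UV g a b → Fin g
  branch (cyc i)    = i
  branch (mid i _)  = i
  branch (pend i _) = i

  depth : UV g a b → ℕ
  depth (cyc _)    = 0
  depth (mid _ _)  = 1
  depth (pend _ _) = 2

  -- the arm of mid i k is mid i k itself together with pend i k when k < a i
  sameArm : UV g a b → UV g a b → Bool
  sameArm (mid i k)  (mid j l)  = eqF i j ∧ (toℕ k ≡ᵇ toℕ l)
  sameArm (mid i k)  (pend j l) = eqF i j ∧ (toℕ k ≡ᵇ toℕ l)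
  sameArm (pend i k) (mid j l)  = eqF i j ∧ (toℕ k ≡ᵇ toℕ l)
  sameArm (pend i k) (pend j l) = eqF i j ∧ (toℕ k ≡ᵇ toℕ l)
  sameArm _          _          = false

  armDist : UV g a b → UV g a b → ℕ
  armDist (mid _ _)  (pend _ _) = 1
  armDist (pend _ _) (mid _ _)  = 1
  armDist _          _          = 0

  throughCycle : UV g a b → UV g a b → ℕ
  throughCycle x y = depth x + depth y + cycleDist (branch x) (branch y)

  udist : UV g a b → UV g a b → ℕ
  udist x y = if sameArm x y then armDist x y else throughCycle x y

  udist-arm : ∀ x y → sameArm x y ≡ true → udist x y ≡ armDist x y
  udist-arm x y same rewrite same = refl

  udist-apart : ∀ x y → sameArm x y ≡ false → udist x y ≡ throughCycle x y
  udist-apart x y apart rewrite apart = refl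

  sameArm-cyc : ∀ x j → sameArm x (cyc j) ≡ false
  sameArm-cyc (cyc _)    j = refl
  sameArm-cyc (mid _ _)  j = refl
  sameArm-cyc (pend _ _) j = refl

  sameArm-branch : ∀ x y → sameArm x y ≡ true → branch x ≡ branch y
  sameArm-branch (mid i k)  (mid j l)  same = eqF-≡ (proj₁ (∧-true⁻ same))
  sameArm-branch (mid i k)  (pend j l) same = eqF-≡ (proj₁ (∧-true⁻ same))
  sameArm-branch (pend i k) (mid j l)  same = eqF-≡ (proj₁ (∧-true⁻ same))
  sameArm-branch (pend i k) (pend j l) same = eqF-≡ (proj₁ (∧-true⁻ same))

  sameArm-apart : ∀ x y → branch x ≢ branch y → sameArm x y ≡ false
  sameArm-apart (cyc _)    _          _ = refl
  sameArm-apart (mid _ _)  (cyc _)    _ = refl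
  sameArm-apart (mid _ _)  (mid _ _)  i≢j rewrite eqF-≢ i≢j = refl
  sameArm-apart (mid _ _)  (pend _ _) i≢j rewrite eqF-≢ i≢j = refl
  sameArm-apart (pend _ _) (cyc _)    _ = refl
  sameArm-apart (pend _ _) (mid _ _)  i≢j rewrite eqF-≢ i≢j = refl
  sameArm-apart (pend _ _) (pend _ _) i≢j rewrite eqF-≢ i≢j = refl

  sameArm-pend : ∀ x j (l : Fin (a j + b j)) (l′ : Fin (a j)) → toℕ l ≡ toℕ l′ → sameArm x (mid j l) ≡ sameArm x (pend j l′)
  sameArm-pend (cyc _)    j l l′ l≡l′ = refl
  sameArm-pend (mid i k)  j l l′ l≡l′ rewrite l≡l′ = refl
  sameArm-pend (pend i k) j l l′ l≡l′ rewrite l≡l′ = refl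

  udist-refl : ∀ x → udist x x ≡ 0
  udist-refl (cyc i)    = cycleDist-refl i
  udist-refl (mid i k)  rewrite eqF-refl i | ≡ᵇ-refl (toℕ k) = refl
  udist-refl (pend i k) rewrite eqF-refl i | ≡ᵇ-refl (toℕ k) = refl

  udist-≡0 : ∀ x v → udist x v ≡ 0 → x ≡ v
  udist-≡0 (cyc i)    (cyc j)    d≡0 = cong cyc (cycleDist-≡0 d≡0)
  udist-≡0 (mid i k)  (mid j l)  d≡0 with sameArm (mid i k) (mid j l) in same
  ... | true with ∧-true⁻ same
  ...   | i≡j , k≡l with eqF-≡ {i = i} {j} i≡j
  ...     | refl = cong (mid i) (toℕ-injective (≡ᵇ-≡ k≡l))
  udist-≡0 (pend i k) (pend j l) d≡0 with sameArm (pend i k) (pend j l) in same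
  ... | true with ∧-true⁻ same
  ...   | i≡j , k≡l with eqF-≡ {i = i} {j} i≡j
  ...     | refl = cong (pend i) (toℕ-injective (≡ᵇ-≡ k≡l))
  udist-≡0 (mid i k)  (pend j l) d≡0 with sameArm (mid i k) (pend j l)
  ... | true with () ← d≡0
  ... | false with () ← d≡0
  udist-≡0 (pend i k) (mid j l)  d≡0 with sameArm (pend i k) (mid j l)
  ... | true with () ← d≡0
  ... | false with () ← d≡0

  armDist-≤1 : ∀ x y → armDist x y ≤ 1
  armDist-≤1 (cyc _)    _          = z≤n
  armDist-≤1 (mid _ _)  (cyc _)    = z≤n
  armDist-≤1 (mid _ _)  (mid _ _)  = z≤n
  armDist-≤1 (mid _ _)  (pend _ _) = ≤-refl
  armDist-≤1 (pend _ _) (cyc _)    = z≤n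
  armDist-≤1 (pend _ _) (mid _ _)  = ≤-refl
  armDist-≤1 (pend _ _) (pend _ _) = z≤n

  udist-arm-≤ : ∀ x v n → sameArm x v ≡ true → udist x v ≤ suc n
  udist-arm-≤ x v n same = ≤-trans (≤-reflexive (udist-arm x v same)) (≤-trans (armDist-≤1 x v) (s≤s z≤n))

  udist-cyc : ∀ x j → udist x (cyc j) ≡ depth x + 0 + cycleDist (branch x) j
  udist-cyc x j = udist-apart x (cyc j) (sameArm-cyc x j)

  sameArm-stem : ∀ x j (l : Fin (a j)) → sameArm x (stem l) ≡ sameArm x (pend j l)
  sameArm-stem x j l = sameArm-pend x j (l ↑ˡ b j) l (toℕ-↑ˡ l (b j))

  descend-root : ∀ x k → depth x + 0 + 0 ≡ suc k → ∃ λ w → Uadj g a b w (cyc (branch x)) ≡ true × udist x w ≡ k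
  descend-root (mid i m)  zero       refl = mid i m , eqF-refl i , udist-refl (mid i m)
  descend-root (pend i m) (suc zero) refl = stem m , eqF-refl i , udist-arm (pend i m) (stem m) same
    where same : sameArm (pend i m) (stem m) ≡ true
          same rewrite eqF-refl i | toℕ-↑ˡ m (b i) = ≡ᵇ-refl (toℕ m)

  descend-cyc : ∀ x j k → udist x (cyc j) ≡ suc k → ∃ λ w → Uadj g a b w (cyc j) ≡ true × udist x w ≡ k
  descend-cyc x j k d≡ with trans (sym (udist-cyc x j)) d≡
  ... | d′≡ with cycleDist (branch x) j in c≡
  ...   | suc c with cycleDist-descend (branch x) j c c≡
  ...     | j′ , j′j , c′≡ = cyc j′ , j′j ,
            trans (udist-cyc x j′) (trans (cong (depth x + 0 +_) c′≡) (suc-injective (trans (sym (+-suc _ c)) d′≡)))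
  descend-cyc x j k d≡ | d′≡ | zero with cycleDist-≡0 c≡
  ... | refl = descend-root x k d′≡

  arm? : ∀ x v → sameArm x v ≡ true ⊎ sameArm x v ≡ false
  arm? x v with sameArm x v
  ... | true  = inj₁ refl
  ... | false = inj₂ refl

  udist-mid-apart : ∀ x j l → sameArm x (mid j l) ≡ false → udist x (mid j l) ≡ suc (udist x (cyc j))
  udist-mid-apart x j l apart =
    trans (udist-apart x _ apart)
          (trans (cong (_+ cycleDist (branch x) j) (+-suc (depth x) 0)) (cong suc (sym (udist-cyc x j))))

  udist-pend-apart : ∀ x j l → sameArm x (pend j l) ≡ false → udist x (pend j l) ≡ suc (udist x (stem l))
  udist-pend-apart x j l apart =
    trans (udist-apart x _ apart)
          (trans (cong (_+ cycleDist (branch x) j) (+-suc (depth x) 1))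
                 (cong suc (sym (udist-apart x (stem l) (trans (sameArm-stem x j l) apart)))))

  udist-descend : ∀ x v k → udist x v ≡ suc k → ∃ λ w → Uadj g a b w v ≡ true × udist x w ≡ k
  udist-descend x (cyc j) k d≡ = descend-cyc x j k d≡
  udist-descend x (mid j l) k d≡ with arm? x (mid j l)
  ... | inj₂ apart = cyc j , eqF-refl j , suc-injective (trans (sym (udist-mid-apart x j l apart)) d≡)
  udist-descend (pend i m) (mid j l) k d≡ | inj₁ same with trans (sym (udist-arm (pend i m) (mid j l) same)) d≡
  ... | refl = pend i m , pend-mid , udist-refl (pend i m)
    where pend-mid : Uadj g a b (pend i m) (mid j l) ≡ true
          pend-mid rewrite ≡ᵇ-sym (toℕ l) (toℕ m) = same
  udist-descend (mid i m) (mid j l) k d≡ | inj₁ same with trans (sym (udist-arm (mid i m) (mid j l) same)) d≡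
  ... | ()
  udist-descend x (pend j l) k d≡ with arm? x (pend j l)
  ... | inj₂ apart = stem l , stem-edge j l , suc-injective (trans (sym (udist-pend-apart x j l apart)) d≡)
  udist-descend (mid i m) (pend j l) k d≡ | inj₁ same with trans (sym (udist-arm (mid i m) (pend j l) same)) d≡
  ... | refl = mid i m , same , udist-refl (mid i m)
  udist-descend (pend i m) (pend j l) k d≡ | inj₁ same with trans (sym (udist-arm (pend i m) (pend j l) same)) d≡
  ... | ()

  depth-≤-armDist : ∀ x j l → sameArm x (mid j l) ≡ true → depth x ≤ suc (armDist x (mid j l))
  depth-≤-armDist (mid _ _)  j l _ = ≤-refl
  depth-≤-armDist (pend _ _) j l _ = ≤-refl

  udist-lipschitz : ∀ x w v → Uadj g a b w v ≡ true → udist x v ≤ suc (udist x w)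
  udist-lipschitz x (cyc i) (cyc j) ij rewrite udist-cyc x i | udist-cyc x j =
    ≤-trans (+-monoʳ-≤ (depth x + 0) (cycleDist-lipschitz (branch x) i j ij)) (≤-reflexive (+-suc _ _))
  udist-lipschitz x (cyc i) (mid j l) ij with eqF-≡ {i = i} {j} ij | arm? x (mid j l)
  ... | refl | inj₁ same  = udist-arm-≤ x (mid j l) _ same
  ... | refl | inj₂ apart = ≤-reflexive (udist-mid-apart x j l apart)
  udist-lipschitz x (mid j l) (cyc i) ji with eqF-≡ {i = j} {i} ji | arm? x (mid j l)
  ... | refl | inj₂ apart rewrite udist-mid-apart x j l apart = m≤n⇒m≤1+n (n≤1+n _)
  ... | refl | inj₁ same  rewrite udist-cyc x j | udist-arm x (mid j l) same | sameArm-branch x (mid j l) same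
                                | cycleDist-refl j | +-identityʳ (depth x + 0) | +-identityʳ (depth x) =
    depth-≤-armDist x j l same
  udist-lipschitz x (mid j l) (pend j′ l′) jl′ with arm? x (pend j′ l′)
  ... | inj₁ same  = udist-arm-≤ x (pend j′ l′) _ same
  ... | inj₂ apart with pend-neighbour (mid j l) (trans (Uadj-sym (pend j′ l′) (mid j l)) jl′)
  ...   | refl = ≤-reflexive (udist-pend-apart x j′ l′ apart)
  udist-lipschitz x (pend j′ l′) (mid j l) l′j with arm? x (mid j l)
  ... | inj₁ same  = udist-arm-≤ x (mid j l) _ same
  ... | inj₂ apart with pend-neighbour (mid j l) l′j
  ...   | refl rewrite udist-pend-apart x j′ l′ (trans (sym (sameArm-stem x j′ l′)) apart) = m≤n⇒m≤1+n (n≤1+n _)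

  udist-isLayering : ∀ x → IsLayering G x (udist x)
  udist-isLayering x = record
    { root      = udist-refl x
    ; root-only = udist-≡0 x
    ; descend   = udist-descend x
    ; lipschitz = udist-lipschitz x
    }

  depth-≤2 : ∀ x → depth x ≤ 2
  depth-≤2 (cyc _)    = z≤n
  depth-≤2 (mid _ _)  = s≤s z≤n
  depth-≤2 (pend _ _) = ≤-refl

  udist-≤ : ∀ x v → udist x v ≤ 4 + pred g
  udist-≤ x v with arm? x v
  ... | inj₁ same  = udist-arm-≤ x v _ same
  ... | inj₂ apart = ≤-trans (≤-reflexive (udist-apart x v apart))
                             (+-mono-≤ (+-mono-≤ (depth-≤2 x) (depth-≤2 v)) (cycleDist-≤ (branch x) (branch v)))

  dist≡udist : g + 4 ≤ order G → ∀ x v → dist G x v ≡ udist x v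
  dist≡udist g+4≤ x v = dist-layering G Uverts-complete (udist-isLayering x) v (≤-trans (s≤s (udist-≤ x v)) 5+pred≤)
    where
      5+pred≤ : 5 + pred g ≤ order G
      5+pred≤ = ≤-trans (≤-reflexive (trans (cong (4 +_) (suc-pred g {{>-nonZero 0<g}})) (+-comm 4 g))) g+4≤

-- The Wiener index of U g a b

wienerList-double : ∀ G → (∀ x y → dist G x y ≡ dist G y x) → (∀ x → dist G x x ≡ 0) →
                    ∀ vs → 2 * wienerList G vs ≡ ∑[ x ← vs ] ∑[ y ← vs ] dist G x y
wienerList-double G sym₀ refl₀ []       = refl
wienerList-double G sym₀ refl₀ (v ∷ vs) rewrite refl₀ v
  | ∑ₗ-distrib-+ vs (λ x → dist G x v) (λ x → ∑[ y ← vs ] dist G x y)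
  | sym (wienerList-double G sym₀ refl₀ vs)
  | ∑ₗ-cong vs (λ x → sym₀ x v) = lemma (∑[ y ← vs ] dist G v y) (wienerList G vs)
  where lemma : ∀ s w → 2 * (s + w) ≡ s + (s + 2 * w)
        lemma = solve-∀

depthSum : ℕ → ℕ → ℕ
depthSum x y = (x + y) + 2 * x

shortcutSum : ℕ → ℕ → ℕ
shortcutSum x y = 2 * (x + y) + 8 * x

module WienerFormula (g : ℕ) (0<g : 0 < g) (a b : Fin g → ℕ) where
  open UDistance g 0<g a b
  open Cycle g 0<g using (cycleDist; cycleDist-refl; weightedDist; energy)
  open UProperties {g} {a} {b} using (Uverts-complete; Uadj-sym; branchSum; ∑-Uverts; order-U)

  Vs : List (UV g a b)
  Vs = Uverts g a b

  size : Fin g → ℕ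
  size i = branchSize (a i) (b i)

  ∑-branchConst : ∀ (φ : Fin g → ℕ) → ∑[ x ← Vs ] φ (branch x) ≡ ∑[ i < g ] (size i * φ i)
  ∑-branchConst φ = trans (∑-Uverts _) (sum-cong-≗ λ i →
    trans (cong (φ i +_) (cong₂ _+_ (∑-const (a i + b i) (φ i)) (∑-const (a i) (φ i)))) (lemma (a i + b i) (a i) (φ i)))
    where lemma : ∀ n m k → k + (n * k + m * k) ≡ (1 + n + m) * k
          lemma = solve-∀

  ∑-depth : ∑[ x ← Vs ] depth x ≡ ∑[ i < g ] depthSum (a i) (b i)
  ∑-depth = trans (∑-Uverts depth) (sum-cong-≗ λ i →
    trans (cong₂ _+_ (∑-const (a i + b i) 1) (∑-const (a i) 2)) (lemma (a i + b i) (a i)))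
    where lemma : ∀ n m → n * 1 + m * 2 ≡ n + 2 * m
          lemma = solve-∀

  -- throughCycle x y − udist x y for x, y in a common arm
  armSaving : UV g a b → UV g a b → ℕ
  armSaving (mid _ _)  (mid _ _)  = 2
  armSaving (mid _ _)  (pend _ _) = 2
  armSaving (pend _ _) (mid _ _)  = 2
  armSaving (pend _ _) (pend _ _) = 4
  armSaving _          _          = 0

  shortcut : UV g a b → UV g a b → ℕ
  shortcut x y = if sameArm x y then armSaving x y else 0

  udist+shortcut : ∀ x y → udist x y + shortcut x y ≡ throughCycle x y
  udist+shortcut x y with arm? x y
  ... | inj₂ apart rewrite udist-apart x y apart | apart = +-identityʳ _
  ... | inj₁ same  rewrite udist-arm x y same | same | sameArm-branch x y same | cycleDist-refl (branch y) = table x y same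
    where
      table : ∀ x y → sameArm x y ≡ true → armDist x y + armSaving x y ≡ depth x + depth y + 0
      table (mid _ _)  (mid _ _)  _ = refl
      table (mid _ _)  (pend _ _) _ = refl
      table (pend _ _) (mid _ _)  _ = refl
      table (pend _ _) (pend _ _) _ = refl

  shortcutRow : UV g a b → ℕ
  shortcutRow (cyc _)    = 0
  shortcutRow (mid i k)  = 2 + (if toℕ k <ᵇ a i then 2 else 0)
  shortcutRow (pend _ _) = 6

  shortcut-otherBranch : ∀ x j → j ≢ branch x → branchSum j (shortcut x) ≡ 0
  shortcut-otherBranch x j j≢ =
    cong₂ _+_ (vanishes (cyc j) refl)
              (cong₂ _+_ (∑-zero _ _ (λ k → vanishes (mid j k) refl)) (∑-zero _ _ (λ l → vanishes (pend j l) refl)))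
    where
      vanishes : ∀ y → branch y ≡ j → shortcut x y ≡ 0
      vanishes y refl rewrite sameArm-apart x y (λ e → j≢ (sym e)) = refl

  shortcut-ownBranch : ∀ x → branchSum (branch x) (shortcut x) ≡ shortcutRow x
  shortcut-ownBranch (cyc i) = cong₂ _+_ (∑-zero (a i + b i) _ (λ _ → refl)) (∑-zero (a i) _ (λ _ → refl))
  shortcut-ownBranch (mid i k) rewrite eqF-refl i
    | ∑-indicator (a i + b i) (toℕ k) 2 | ∑-indicator (a i) (toℕ k) 2 | <ᵇ-true (toℕ<n k) = refl
  shortcut-ownBranch (pend i k) rewrite eqF-refl i
    | ∑-indicator (a i + b i) (toℕ k) 2 | ∑-indicator (a i) (toℕ k) 4
    | <ᵇ-true (≤-trans (toℕ<n k) (m≤m+n (a i) (b i))) | <ᵇ-true (toℕ<n k) = refl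

  shortcut-row : ∀ x → ∑[ y ← Vs ] shortcut x y ≡ shortcutRow x
  shortcut-row x = trans (∑-Uverts _) (trans (∑-single g _ (branch x) (shortcut-otherBranch x)) (shortcut-ownBranch x))

  ∑-shortcut : ∑[ x ← Vs ] ∑[ y ← Vs ] shortcut x y ≡ ∑[ i < g ] shortcutSum (a i) (b i)
  ∑-shortcut = trans (∑ₗ-cong Vs shortcut-row) (trans (∑-Uverts shortcutRow) (sum-cong-≗ λ i →
    trans (cong₂ _+_ (trans (∑-distrib-+ {a i + b i} (λ _ → 2) (λ l → if toℕ l <ᵇ a i then 2 else 0))
                            (cong₂ _+_ (∑-const (a i + b i) 2) (∑-below (a i) (b i) 2)))
                     (∑-const (a i) 6))
          (lemma (a i) (b i))))
    where lemma : ∀ x y → (x + y) * 2 + x * 2 + x * 6 ≡ 2 * (x + y) + 8 * x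
          lemma = solve-∀

  N H : ℕ
  N = ∑[ i < g ] size i
  H = ∑[ i < g ] depthSum (a i) (b i)

  ∑-throughCycle-row : ∀ x → ∑[ y ← Vs ] throughCycle x y ≡ N * depth x + H + weightedDist size (branch x)
  ∑-throughCycle-row x = begin
    ∑[ y ← Vs ] (depth x + depth y + cycleDist (branch x) (branch y))
      ≡⟨ ∑ₗ-distrib-+ Vs _ _ ⟩
    ∑[ y ← Vs ] (depth x + depth y) + ∑[ y ← Vs ] cycleDist (branch x) (branch y)
      ≡⟨ cong₂ _+_ (∑ₗ-distrib-+ Vs _ _) (∑-branchConst (cycleDist (branch x))) ⟩
    ∑[ y ← Vs ] depth x + ∑[ y ← Vs ] depth y + weightedDist size (branch x)
      ≡⟨ cong (λ t → t + ∑[ y ← Vs ] depth y + weightedDist size (branch x))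
              (trans (∑ₗ-const Vs (depth x)) (cong (_* depth x) order-U)) ⟩
    N * depth x + ∑[ y ← Vs ] depth y + weightedDist size (branch x)
      ≡⟨ cong (λ t → N * depth x + t + weightedDist size (branch x)) ∑-depth ⟩
    N * depth x + H + weightedDist size (branch x) ∎
    where open ≡-Reasoning

  ∑-throughCycle : ∑[ x ← Vs ] ∑[ y ← Vs ] throughCycle x y ≡ N * H + N * H + energy size
  ∑-throughCycle = begin
    ∑[ x ← Vs ] ∑[ y ← Vs ] throughCycle x y
      ≡⟨ ∑ₗ-cong Vs ∑-throughCycle-row ⟩
    ∑[ x ← Vs ] (N * depth x + H + weightedDist size (branch x))
      ≡⟨ ∑ₗ-distrib-+ Vs _ _ ⟩
    ∑[ x ← Vs ] (N * depth x + H) + ∑[ x ← Vs ] weightedDist size (branch x)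
      ≡⟨ cong₂ _+_ (∑ₗ-distrib-+ Vs _ _) (∑-branchConst (weightedDist size)) ⟩
    ∑[ x ← Vs ] (N * depth x) + ∑[ x ← Vs ] H + energy size
      ≡⟨ cong (_+ energy size) (cong₂ _+_ (trans (*-distribˡ-∑ₗ Vs N depth) (cong (N *_) ∑-depth))
                               (trans (∑ₗ-const Vs H) (cong (_* H) order-U))) ⟩
    N * H + N * H + energy size ∎
    where open ≡-Reasoning

  wiener-formula : g + 4 ≤ order G → 2 * W G + ∑[ i < g ] shortcutSum (a i) (b i) ≡ N * H + N * H + energy size
  wiener-formula g+4≤ = begin
    2 * W G + ∑[ i < g ] shortcutSum (a i) (b i)
      ≡⟨ cong₂ _+_ (wienerList-double G (dist-sym G Uverts-complete Uadj-sym)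
                                         (λ x → trans (dist≡udist g+4≤ x x) (udist-refl x)) Vs)
                   (sym ∑-shortcut) ⟩
    ∑[ x ← Vs ] ∑[ y ← Vs ] dist G x y + ∑[ x ← Vs ] ∑[ y ← Vs ] shortcut x y
      ≡⟨ sym (∑ₗ-distrib-+ Vs _ _) ⟩
    ∑[ x ← Vs ] (∑[ y ← Vs ] dist G x y + ∑[ y ← Vs ] shortcut x y)
      ≡⟨ ∑ₗ-cong Vs (λ x → trans (sym (∑ₗ-distrib-+ Vs _ _)) (∑ₗ-cong Vs λ y →
           trans (cong (_+ shortcut x y) (dist≡udist g+4≤ x y)) (udist+shortcut x y))) ⟩
    ∑[ x ← Vs ] ∑[ y ← Vs ] throughCycle x y
      ≡⟨ ∑-throughCycle ⟩
    N * H + N * H + energy size ∎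
    where open ≡-Reasoning

-- Moving arms decreases the Wiener index

module TwoPoints {g : ℕ} (p q : Fin g) where

  outside : (Fin g → ℕ) → Fin g → ℕ
  outside f i = if eqF i p then 0 else (if eqF i q then 0 else f i)

  rest : (Fin g → ℕ) → ℕ
  rest f = ∑[ i < g ] outside f i

  private
    only : Fin g → ℕ → Fin g → ℕ
    only i v j = if eqF j i then v else 0

    ∑-only : ∀ i v → ∑[ j < g ] only i v j ≡ v
    ∑-only i v = trans (∑-single g (only i v) i (λ j j≢i → cong (if_then v else 0) (eqF-≢ j≢i)))
                       (cong (if_then v else 0) (eqF-refl i))

    decompose : p ≢ q → ∀ f i → f i ≡ only p (f p) i + (only q (f q) i + outside f i)
    decompose p≢q f i with i ≟F p | i ≟F q
    ... | yes refl | yes p≡q = ⊥-elim (p≢q p≡q)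
    ... | yes refl | no _    = sym (+-identityʳ _)
    ... | no _     | yes refl = sym (+-identityʳ _)
    ... | no _     | no _    = refl

  ∑-split : p ≢ q → ∀ f → ∑[ i < g ] f i ≡ f p + f q + rest f
  ∑-split p≢q f = begin
    ∑[ i < g ] f i
      ≡⟨ sum-cong-≗ (decompose p≢q f) ⟩
    ∑[ i < g ] (only p (f p) i + (only q (f q) i + outside f i))
      ≡⟨ ∑-distrib-+ (only p (f p)) _ ⟩
    ∑[ i < g ] only p (f p) i + ∑[ i < g ] (only q (f q) i + outside f i)
      ≡⟨ cong₂ _+_ (∑-only p (f p)) (trans (∑-distrib-+ (only q (f q)) _) (cong (_+ rest f) (∑-only q (f q)))) ⟩
    f p + (f q + rest f)
      ≡⟨ +-assoc (f p) (f q) (rest f) ⟨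
    f p + f q + rest f ∎
    where open ≡-Reasoning

  rest-cong : ∀ f f' → (∀ i → i ≢ p → i ≢ q → f i ≡ f' i) → rest f ≡ rest f'
  rest-cong f f' f≗f' = sum-cong-≗ pointwise
    where
      pointwise : ∀ i → outside f i ≡ outside f' i
      pointwise i with i ≟F p | i ≟F q
      ... | yes _ | _     = refl
      ... | no _  | yes _ = refl
      ... | no i≢p | no i≢q = f≗f' i i≢p i≢q

  rest-+ : ∀ f f' → rest (λ i → f i + f' i) ≡ rest f + rest f'
  rest-+ f f' = trans (sum-cong-≗ pointwise) (∑-distrib-+ (outside f) (outside f'))
    where
      pointwise : ∀ i → outside (λ i → f i + f' i) i ≡ outside f i + outside f' i
      pointwise i with i ≟F p | i ≟F q
      ... | yes _ | _     = refl
      ... | no _  | yes _ = refl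
      ... | no _  | no _  = refl

  rest-*ˡ : ∀ k f → rest (λ i → k * f i) ≡ k * rest f
  rest-*ˡ k f = trans (sum-cong-≗ pointwise) (sym (*-distribˡ-sum k (outside f)))
    where
      pointwise : ∀ i → outside (λ i → k * f i) i ≡ k * outside f i
      pointwise i with i ≟F p | i ≟F q
      ... | yes _ | _     = sym (*-zeroʳ k)
      ... | no _  | yes _ = sym (*-zeroʳ k)
      ... | no _  | no _  = refl

rest-swap : ∀ {g} (p q : Fin g) f → TwoPoints.rest q p f ≡ TwoPoints.rest p q f
rest-swap p q f = sum-cong-≗ pointwise
  where
    pointwise : ∀ i → TwoPoints.outside q p f i ≡ TwoPoints.outside p q f i
    pointwise i with i ≟F p | i ≟F q
    ... | yes _ | yes _ = refl
    ... | yes _ | no _  = refl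
    ... | no _  | yes _ = refl
    ... | no _  | no _  = refl

module CycleEnergy (g : ℕ) (0<g : 0 < g) (p q : Fin g) (p≢q : p ≢ q) where
  open Cycle g 0<g using (cycleDist; cycleDist-refl; cycleDist-sym; weightedDist; energy)
  open TwoPoints p q

  pull : Fin g → (Fin g → ℕ) → ℕ
  pull r u = rest (λ j → u j * cycleDist r j)

  restEnergy : (Fin g → ℕ) → ℕ
  restEnergy u = rest (λ i → u i * rest (λ j → u j * cycleDist i j))

  d : ℕ
  d = cycleDist p q

  energy-split : ∀ u → energy u ≡ u p * (u q * d + pull p u) + u q * (u p * d + pull q u)
                                  + u p * pull p u + u q * pull q u + restEnergy u
  energy-split u = begin
    energy u
      ≡⟨ ∑-split p≢q _ ⟩
    u p * weightedDist u p + u q * weightedDist u q + rest (λ i → u i * weightedDist u i)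
      ≡⟨ cong₂ _+_ (cong₂ _+_ (cong (u p *_) row-p) (cong (u q *_) row-q)) rest-rows ⟩
    u p * (u q * d + pull p u) + u q * (u p * d + pull q u) + (u p * pull p u + u q * pull q u + restEnergy u)
      ≡⟨ lemma (u p * (u q * d + pull p u)) (u q * (u p * d + pull q u)) (u p * pull p u) (u q * pull q u) (restEnergy u) ⟩
    u p * (u q * d + pull p u) + u q * (u p * d + pull q u) + u p * pull p u + u q * pull q u + restEnergy u ∎
    where
      open ≡-Reasoning
      lemma : ∀ A B C D E → A + B + (C + D + E) ≡ A + B + C + D + E
      lemma = solve-∀
      row-p : weightedDist u p ≡ u q * d + pull p u
      row-p rewrite ∑-split p≢q (λ j → u j * cycleDist p j) | cycleDist-refl p | *-zeroʳ (u p) = refl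
      row-q : weightedDist u q ≡ u p * d + pull q u
      row-q rewrite ∑-split p≢q (λ j → u j * cycleDist q j) | cycleDist-refl q | *-zeroʳ (u q)
                  | cycleDist-sym q p | +-identityʳ (u p * cycleDist p q) = refl
      row-other : ∀ i → u i * weightedDist u i
                        ≡ u p * (u i * cycleDist p i) + u q * (u i * cycleDist q i) + u i * rest (λ j → u j * cycleDist i j)
      row-other i rewrite ∑-split p≢q (λ j → u j * cycleDist i j) | cycleDist-sym i p | cycleDist-sym i q =
        lemma′ (u i) (u p) (u q) (cycleDist p i) (cycleDist q i) (rest (λ j → u j * cycleDist i j))
        where lemma′ : ∀ ui up uq cp cq R → ui * (up * cp + uq * cq + R) ≡ up * (ui * cp) + uq * (ui * cq) + ui * R
              lemma′ = solve-∀
      rest-rows : rest (λ i → u i * weightedDist u i) ≡ u p * pull p u + u q * pull q u + restEnergy u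
      rest-rows = begin
        rest (λ i → u i * weightedDist u i)
          ≡⟨ rest-cong _ _ (λ i _ _ → row-other i) ⟩
        rest (λ i → u p * (u i * cycleDist p i) + u q * (u i * cycleDist q i) + u i * rest (λ j → u j * cycleDist i j))
          ≡⟨ rest-+ _ _ ⟩
        rest (λ i → u p * (u i * cycleDist p i) + u q * (u i * cycleDist q i)) + restEnergy u
          ≡⟨ cong (_+ restEnergy u) (trans (rest-+ _ _) (cong₂ _+_ (rest-*ˡ (u p) _) (rest-*ˡ (u q) _))) ⟩
        u p * pull p u + u q * pull q u + restEnergy u ∎

  private
    weighted-off : ∀ {u u′ : Fin g → ℕ} → (∀ i → i ≢ p → i ≢ q → u′ i ≡ u i) →
                   ∀ r j → j ≢ p → j ≢ q → u′ j * cycleDist r j ≡ u j * cycleDist r j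
    weighted-off same-off r j j≢p j≢q = cong (_* cycleDist r j) (same-off j j≢p j≢q)

  -- energy u − energy u′ = 8 x y d + 4 y (pull q u − pull p u), with both sides moved so that no subtraction occurs.
  energy-merge : ∀ x y (u u′ : Fin g → ℕ) →
                 u p ≡ branchSize x 0 → u q ≡ branchSize y 0 → u′ p ≡ branchSize (x + y) 0 → u′ q ≡ branchSize 0 0 →
                 (∀ i → i ≢ p → i ≢ q → u′ i ≡ u i) →
                 energy u + 4 * y * pull p u ≡ energy u′ + 4 * y * pull q u + 8 * x * y * d
  energy-merge x y u u′ up uq u′p u′q same-off
    rewrite energy-split u | energy-split u′ | up | uq | u′p | u′q
          | rest-cong (λ j → u′ j * cycleDist p j) (λ j → u j * cycleDist p j) (weighted-off same-off p)
          | rest-cong (λ j → u′ j * cycleDist q j) (λ j → u j * cycleDist q j) (weighted-off same-off q)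
          | rest-cong (λ i → u′ i * rest (λ j → u′ j * cycleDist i j)) (λ i → u i * rest (λ j → u j * cycleDist i j))
              (λ i i≢p i≢q → cong₂ _*_ (same-off i i≢p i≢q) (rest-cong _ _ (weighted-off same-off i)))
    = lemma x y d (pull p u) (pull q u) (restEnergy u)
    where
      lemma : ∀ x y d P Q Z →
              (1 + (x + 0) + x) * ((1 + (y + 0) + y) * d + P) + (1 + (y + 0) + y) * ((1 + (x + 0) + x) * d + Q)
              + (1 + (x + 0) + x) * P + (1 + (y + 0) + y) * Q + Z + 4 * y * P
              ≡ (1 + (x + y + 0) + (x + y)) * ((1 + (0 + 0) + 0) * d + P) + (1 + (0 + 0) + 0) * ((1 + (x + y + 0) + (x + y)) * d + Q)
                + (1 + (x + y + 0) + (x + y)) * P + (1 + (0 + 0) + 0) * Q + Z + 4 * y * Q + 8 * x * y * d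
      lemma = solve-∀

module MergeWiener {g : ℕ} (0<g : 0 < g) {p q : Fin g} {a b a' b' : Fin g → ℕ}
                   (merge : IsArmMerge p q a b a' b') (1≤ap : 1 ≤ a p) (1≤aq : 1 ≤ a q) where
  open IsArmMerge merge
  open TwoPoints p q
  open CycleEnergy g 0<g p q p≢q
  open Cycle g 0<g using (cycleDist; cycleDist-≡0; energy)
  module F  = WienerFormula g 0<g a b
  module F′ = WienerFormula g 0<g a' b'

  ∑-merge : ∀ (φ : ℕ → ℕ → ℕ) → φ (a p) 0 + φ (a q) 0 ≡ φ (a p + a q) 0 + φ 0 0 →
            ∑[ i < g ] φ (a i) (b i) ≡ ∑[ i < g ] φ (a' i) (b' i)
  ∑-merge φ at-pq = begin
    ∑[ i < g ] φ (a i) (b i)                                   ≡⟨ ∑-split p≢q _ ⟩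
    φ (a p) (b p) + φ (a q) (b q) + rest (λ i → φ (a i) (b i))  ≡⟨ cong₂ _+_ pq (rest-cong _ _ off) ⟩
    φ (a' p) (b' p) + φ (a' q) (b' q) + rest (λ i → φ (a' i) (b' i)) ≡⟨ ∑-split p≢q _ ⟨
    ∑[ i < g ] φ (a' i) (b' i)                                 ∎
    where
      open ≡-Reasoning
      pq : φ (a p) (b p) + φ (a q) (b q) ≡ φ (a' p) (b' p) + φ (a' q) (b' q)
      pq rewrite b-p | b-q | a'-p | a'-q | b'-p | b'-q = at-pq
      off : ∀ i → i ≢ p → i ≢ q → φ (a i) (b i) ≡ φ (a' i) (b' i)
      off i i≢p i≢q rewrite a'-other i i≢p i≢q | b'-other i i≢p i≢q = refl

  size-merge : F.N ≡ F′.N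
  size-merge = ∑-merge branchSize (lemma (a p) (a q))
    where lemma : ∀ x y → 1 + (x + 0) + x + (1 + (y + 0) + y) ≡ 1 + (x + y + 0) + (x + y) + (1 + (0 + 0) + 0)
          lemma = solve-∀

  depth-merge : F.H ≡ F′.H
  depth-merge = ∑-merge depthSum (lemma (a p) (a q))
    where lemma : ∀ x y → x + 0 + 2 * x + (y + 0 + 2 * y) ≡ x + y + 0 + 2 * (x + y) + (0 + 0 + 2 * 0)
          lemma = solve-∀

  shortcut-merge : ∑[ i < g ] shortcutSum (a i) (b i) ≡ ∑[ i < g ] shortcutSum (a' i) (b' i)
  shortcut-merge = ∑-merge shortcutSum (lemma (a p) (a q))
    where lemma : ∀ x y → 2 * (x + 0) + 8 * x + (2 * (y + 0) + 8 * y) ≡ 2 * (x + y + 0) + 8 * (x + y) + (2 * (0 + 0) + 8 * 0)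
          lemma = solve-∀

  order-≥ : ∀ {c e : Fin g → ℕ} → 4 ≤ (c p + e p + c p) + (c q + e q + c q) → g + 4 ≤ order (U g c e)
  order-≥ {c} {e} 4≤ = begin
    g + 4                                       ≤⟨ +-monoʳ-≤ g (≤-trans 4≤ (m≤m+n _ (rest t))) ⟩
    g + (t p + t q + rest t)                    ≡⟨ cong₂ _+_ (sym (trans (∑-const g 1) (*-identityʳ g))) (sym (∑-split p≢q t)) ⟩
    ∑[ i < g ] 1 + ∑[ i < g ] t i               ≡⟨ ∑-distrib-+ (λ _ → 1) t ⟨
    ∑[ i < g ] branchSize (c i) (e i)           ≡⟨ UProperties.order-U {g} {c} {e} ⟨
    order (U g c e)                             ∎
    where
      open ≤-Reasoning
      t : Fin g → ℕ
      t i = c i + e i + c i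

  size-p : F.size p ≡ branchSize (a p) 0
  size-p = cong (branchSize (a p)) b-p

  size-q : F.size q ≡ branchSize (a q) 0
  size-q = cong (branchSize (a q)) b-q

  size′-p : F′.size p ≡ branchSize (a p + a q) 0
  size′-p = cong₂ branchSize a'-p b'-p

  size′-q : F′.size q ≡ branchSize 0 0
  size′-q = cong₂ branchSize a'-q b'-q

  size-off : ∀ i → i ≢ p → i ≢ q → F′.size i ≡ F.size i
  size-off i i≢p i≢q = cong₂ branchSize (a'-other i i≢p i≢q) (b'-other i i≢p i≢q)

  arm-twice : ∀ {x y n} → n ≤ x → n + n ≤ x + y + x
  arm-twice {x} {y} n≤x = +-mono-≤ (≤-trans n≤x (m≤m+n x y)) n≤x

  P Q : ℕ
  P = pull p F.size
  Q = pull q F.size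

  wiener-key : 2 * W (U g a b) + 4 * a q * P ≡ 2 * W (U g a' b') + (4 * a q * Q + 8 * a p * a q * d)
  wiener-key = +-cancelʳ-≡ S _ _ (begin
    2 * W G + 4 * a q * P + S                     ≡⟨ swap-last (2 * W G) _ S ⟩
    2 * W G + S + 4 * a q * P                     ≡⟨ cong (_+ 4 * a q * P) (F.wiener-formula order-G) ⟩
    A + energy F.size + 4 * a q * P               ≡⟨ +-assoc A _ _ ⟩
    A + (energy F.size + 4 * a q * P)
      ≡⟨ cong (A +_) (energy-merge (a p) (a q) F.size F′.size size-p size-q size′-p size′-q size-off) ⟩
    A + (energy F′.size + 4 * a q * Q + 8 * a p * a q * d) ≡⟨ lemma A _ _ _ ⟩
    A + energy F′.size + (4 * a q * Q + 8 * a p * a q * d) ≡⟨ cong (_+ (4 * a q * Q + 8 * a p * a q * d)) (sym e′) ⟩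
    2 * W G′ + S + (4 * a q * Q + 8 * a p * a q * d)   ≡⟨ swap-last (2 * W G′) S _ ⟩
    2 * W G′ + (4 * a q * Q + 8 * a p * a q * d) + S ∎)
    where
      open ≡-Reasoning
      G = U g a b
      G′ = U g a' b'
      S = ∑[ i < g ] shortcutSum (a i) (b i)
      A = F.N * F.H + F.N * F.H
      swap-last : ∀ x y z → x + y + z ≡ x + z + y
      swap-last = solve-∀
      lemma : ∀ A E T U → A + (E + T + U) ≡ A + E + (T + U)
      lemma = solve-∀
      order-G : g + 4 ≤ order G
      order-G = order-≥ (+-mono-≤ (arm-twice 1≤ap) (arm-twice 1≤aq))
      order-G′ : g + 4 ≤ order G′
      order-G′ = order-≥ (≤-trans (arm-twice 2≤a'p) (m≤m+n _ _))
        where 2≤a'p = subst (2 ≤_) (sym a'-p) (+-mono-≤ 1≤ap 1≤aq)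
      e′ : 2 * W G′ + S ≡ A + energy F′.size
      e′ = trans (cong (2 * W G′ +_) shortcut-merge)
                 (trans (F′.wiener-formula order-G′)
                        (cong (_+ energy F′.size) (sym (cong₂ (λ n h → n * h + n * h) size-merge depth-merge))))

  1≤d : 1 ≤ d
  1≤d with cycleDist p q in d≡
  ... | zero  = ⊥-elim (p≢q (cycleDist-≡0 d≡))
  ... | suc _ = s≤s z≤n

  wiener-merge-< : P ≤ Q → W (U g a' b') < W (U g a b)
  wiener-merge-< P≤Q = *-cancelˡ-< 2 _ _ (begin-strict
    2 * W G′                                        <⟨ m<m+n (2 * W G′) 0<gain ⟩
    2 * W G′ + gain                                 ≤⟨ +-cancelʳ-≤ (4 * a q * Q) _ _ (begin
      2 * W G′ + gain + 4 * a q * Q                 ≡⟨ rearrange (2 * W G′) gain (4 * a q * Q) ⟩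
      2 * W G′ + (4 * a q * Q + gain)               ≡⟨ wiener-key ⟨
      2 * W G + 4 * a q * P                         ≤⟨ +-monoʳ-≤ (2 * W G) (*-monoʳ-≤ (4 * a q) P≤Q) ⟩
      2 * W G + 4 * a q * Q                         ∎) ⟩
    2 * W G                                         ∎)
    where
      open ≤-Reasoning
      G = U g a b
      G′ = U g a' b'
      gain = 8 * a p * a q * d
      0<gain : 0 < gain
      0<gain = *-mono-≤ (*-mono-≤ (*-mono-≤ (s≤s (z≤n {7})) 1≤ap) 1≤aq) 1≤d
      rearrange : ∀ x y z → x + y + z ≡ x + (z + y)
      rearrange = solve-∀

module _ {g : ℕ} (f : Fin g → ℕ) (p : Fin g) (x : ℕ) (q : Fin g) (y : ℕ) where

  replace2-p : replace2 f p x q y p ≡ x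
  replace2-p rewrite eqF-refl p = refl

  replace2-q : q ≢ p → replace2 f p x q y q ≡ y
  replace2-q q≢p rewrite eqF-≢ q≢p | eqF-refl q = refl

  replace2-other : ∀ i → i ≢ p → i ≢ q → replace2 f p x q y i ≡ f i
  replace2-other i i≢p i≢q rewrite eqF-≢ i≢p | eqF-≢ i≢q = refl

module _ {g : ℕ} {a b : Fin g → ℕ} {p q : Fin g} (p≢q : p ≢ q) (bp≡0 : b p ≡ 0) (bq≡0 : b q ≡ 0) where
  private
    q≢p : q ≢ p
    q≢p = λ q≡p → p≢q (sym q≡p)

  merge-into-p : IsArmMerge p q a b (replace2 a p (a p + a q) q 0) (replace2 b p 0 q 0)
  merge-into-p = record
    { p≢q = p≢q ; b-p = bp≡0 ; b-q = bq≡0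
    ; a'-p = replace2-p a p _ q 0 ; a'-q = replace2-q a p _ q 0 q≢p
    ; b'-p = replace2-p b p 0 q 0 ; b'-q = replace2-q b p 0 q 0 q≢p
    ; a'-other = replace2-other a p _ q 0 ; b'-other = replace2-other b p 0 q 0
    }

  merge-into-q : IsArmMerge q p a b (replace2 a p 0 q (a p + a q)) (replace2 b p 0 q 0)
  merge-into-q = record
    { p≢q = q≢p ; b-p = bq≡0 ; b-q = bp≡0
    ; a'-p = trans (replace2-q a p 0 q _ q≢p) (+-comm (a p) (a q)) ; a'-q = replace2-p a p 0 q _
    ; b'-p = replace2-q b p 0 q 0 q≢p ; b'-q = replace2-p b p 0 q 0
    ; a'-other = λ i i≢q i≢p → replace2-other a p 0 q _ i i≢p i≢q
    ; b'-other = λ i i≢q i≢p → replace2-other b p 0 q 0 i i≢p i≢q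
    }

wiener-opposite-merges : ∀ {g} {p q : Fin g} {a b a₁ b₁ a₂ b₂ : Fin g → ℕ} → 0 < g →
                         IsArmMerge p q a b a₁ b₁ → IsArmMerge q p a b a₂ b₂ → 1 ≤ a p → 1 ≤ a q →
                         W (U g a₁ b₁) ⊓ W (U g a₂ b₂) < W (U g a b)
wiener-opposite-merges {p = p} {q} 0<g into-p into-q 1≤ap 1≤aq =
  [ (λ P≤Q → ≤-<-trans (m⊓n≤m _ _) (Wp.wiener-merge-< P≤Q))
  , (λ Q≤P → ≤-<-trans (m⊓n≤n _ _)
                 (Wq.wiener-merge-< (subst₂ _≤_ (sym (rest-swap p q _)) (sym (rest-swap p q _)) Q≤P)))
  ]′ (≤-total Wp.P Wp.Q)
  where
    module Wp = MergeWiener 0<g into-p 1≤ap 1≤aq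
    module Wq = MergeWiener 0<g into-q 1≤aq 1≤ap

corollary2p10 : (g : ℕ) → 3 ≤ g → (a b : Fin g → ℕ) → (p q : Fin g) → p ≢ q →
    b p ≡ 0 → b q ≡ 0 → 1 ≤ a p → 1 ≤ a q →
    (Σ ℕ λ m → IsMatchingNumber (U g a b) m
             × IsMatchingNumber (U g (replace2 a p (a p + a q) q 0) (replace2 b p 0 q 0)) m
             × IsMatchingNumber (U g (replace2 a p 0 q (a p + a q)) (replace2 b p 0 q 0)) m)
    × (W (U g (replace2 a p (a p + a q) q 0) (replace2 b p 0 q 0))
       ⊓ W (U g (replace2 a p 0 q (a p + a q)) (replace2 b p 0 q 0))
       < W (U g a b))
corollary2p10 g 3≤g a b p q p≢q bp≡0 bq≡0 1≤ap 1≤aq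
  with Matchings.maximumMatching-exists (U g a b) UProperties.Uverts-complete
... | m , isν =
  (m , isν , IsMatchingNumber-merge into-p isν , IsMatchingNumber-merge into-q isν) ,
  wiener-opposite-merges (≤-trans (s≤s z≤n) 3≤g) into-p into-q 1≤ap 1≤aq
  where
    into-p : IsArmMerge p q a b (replace2 a p (a p + a q) q 0) (replace2 b p 0 q 0)
    into-p = merge-into-p p≢q bp≡0 bq≡0
    into-q : IsArmMerge q p a b (replace2 a p 0 q (a p + a q)) (replace2 b p 0 q 0)
    into-q = merge-into-q p≢q bp≡0 bq≡0
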